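{- Let $\phi$ be an unsatisfiable $3$-CNF and $G_\phi$ its adjacency graph. If Coverer wins the cover game $\mathsf{CoverGame}(G_\phi,\mu)$, then there is a $\mu$-winning strategy for $tr(\phi)$.
   Context: Let $X$ be the variables of $\phi$, $\overline X=\{\bar x: x\in X\}$, $\mathbb F$ a field. The adjacency graph $G_\phi$ is the bipartite graph with bipartition $(L,R)$, $L$ the clauses of $\phi$, $R = X$, and $C$ adjacent to $x$ iff $x$ or $\neg x$ occurs in $C$. A $(2,4)$-matching in a bipartite graph with bipartition $(L,R)$ is a subgraph $F$ whose connected components are trees with at most $4$ edges and in which each vertex of $V(F)\cap L$ has degree exactly $2$; $F$ covers $v$ if $v\in V(F)$. The cover game $\mathsf{CoverGame}(G,\mu)$ is played by Chooser and Coverer who maintain a $(2,4)$-matching $F_i$ in $G$ (initially empty); at step $i+1$ Chooser either removes a connected component of $F_i$, or, if $F_i$ has fewer than $\mu$ components, picks a vertex of $G$ and Coverer must produce a $(2,4)$-matching $F_{i+1}$ in $G$ covering that vertex in which every component of $F_i$ is a component of $F_{i+1}$; Coverer wins if she has a strategy answering every challenge in every play. The encoding is $tr(\phi) = \{tr(C): C\in\phi\}\cup\{x^2-x,\ x+\bar x-1: x\in X\}\subseteq\mathbb F[X,\overline X]$ with $tr(x)=\bar x$, $tr(\neg x)=x$, $tr(\ell_1\vee\dots\vee\ell_n)=\prod_i tr(\ell_i)$. Partial assignments $\alpha: X\to\{0,1,\star\}$ (domain $\alpha^{ -1}(\{0,1\})$, extended by $\alpha(\bar x)=1-\alpha(x)$;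 $\star$ has empty domain); $\alpha\models p$ means substituting $\alpha$ into $p$ gives the zero polynomial. A set $A$ of partial assignments is flippable if for every $x$ in the union of their domains there are $\alpha,\beta\in A$ with $\alpha(x)=1-\beta(x)$. For non-empty pairwise domain-disjoint $H_1,\dots,H_t$, the product-family $H_1\otimes\dots\otimes H_t=\{\alpha_1\cup\dots\cup\alpha_t:\alpha_i\in H_i\}$ ($\{\star\}$ if $t=0$); it is flippable if every factor $H_i$ is flippable; its rank $\|\mathcal H\|$ is the number of factors different from $\{\star\}$; $\mathcal H'\sqsubseteq\mathcal H$ means every factor of $\mathcal H'$ other than $\{\star\}$ is a factor of $\mathcal H$; $\mathcal H\models p$ means $\alpha\models p$ for all $\alpha\in\mathcal H$. For a set $P$ of polynomials, a non-empty family $\mathcal L$ of flippable product-families is a $k$-winning strategy for $P$ if for every $\mathcal H\in\mathcal L$: every $\mathcal H'\sqsubseteq\mathcal H$ lies in $\mathcal L$, and if $\|\mathcal H\|<k$ then for each $p\in P$ there is a flippable product-family $\mathcal H'\in\mathcal L$ with $\mathcal H\sqsubseteq\mathcal H'$ and $\mathcal H'\models p$. -}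

module Defs where

open import Level using (Level; _⊔_) renaming (suc to lsuc)
open import Algebra.Bundles using (CommutativeRing)
open import Data.Nat using (ℕ; zero; suc; _+_; _≤_; _<_)
import Data.Nat as ℕ
open import Data.Bool using (Bool; true; false; not; _∧_; if_then_else_; T)
open import Data.Fin using (Fin)
import Data.Fin as Fin
open import Data.Fin.Properties using (all?)
open import Data.Maybe using (Maybe; just; nothing)
open import Data.List using (List; []; _∷_; _++_; length; map; foldr; allFin; concatMap)
open import Data.Nat.ListAction using (sum)
open import Data.Empty using (⊥)
open import Data.List.Membership.Propositional using (_∈_)
open import Data.List.Relation.Unary.Any using (Any)
open import Data.List.Relation.Unary.All using (All)
open import Data.List.Relation.Unary.AllPairs using (AllPairs)
open import Data.List.Relation.Unary.Unique.Propositional using (Unique)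
open import Data.Vec using (Vec; lookup; replicate; zipWith)
open import Data.Product using (Σ; ∃; ∃₂; _×_; _,_; proj₁; proj₂)
open import Data.Sum using (_⊎_; inj₁; inj₂)
open import Relation.Nullary using (¬_; does)
open import Relation.Binary.PropositionalEquality using (_≡_)
open import Relation.Binary.Construct.Closure.ReflexiveTransitive using (Star)

record Field (c ℓ : Level) : Set (lsuc (c ⊔ ℓ)) where
  field
    commutativeRing : CommutativeRing c ℓ
  open CommutativeRing commutativeRing public
  field
    0≉1     : ¬ (0# ≈ 1#)
    inverse : ∀ x → ¬ (x ≈ 0#) → Σ Carrier (λ y → (x * y) ≈ 1#)

-- CNFs over the variables Fin n with m clauses (clauses indexed by Fin m).
-- A literal (x , true) is the positive literal x, (x , false) is ¬x.

Literal : ℕ → Set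
Literal n = Fin n × Bool

Clause : ℕ → Set
Clause n = List (Literal n)

CNF : ℕ → ℕ → Set
CNF n m = Fin m → Clause n

Occurs : ∀ {n m} → CNF n m → Fin m → Fin n → Set
Occurs φ C x = Any (λ l → proj₁ l ≡ x) (φ C)

record Is3CNF {n m : ℕ} (φ : CNF n m) : Set where
  field
    width≤3          : ∀ C → length (φ C) ≤ 3
    literalsDistinct : ∀ C → Unique (φ C)
    clausesDistinct  : ∀ C D → (∀ l → (l ∈ φ C → l ∈ φ D) × (l ∈ φ D → l ∈ φ C)) → C ≡ D

-- X = Fin n is exactly the set of variables of φ
AllVarsOccur : ∀ {n m} → CNF n m → Set
AllVarsOccur {n} {m} φ = ∀ (x : Fin n) → ∃ λ (C : Fin m) → Occurs φ C x

Satisfies : ∀ {n m} → (Fin n → Bool) → CNF n m → Set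
Satisfies a φ = ∀ C → Any (λ l → a (proj₁ l) ≡ proj₂ l) (φ C)

Unsatisfiable : ∀ {n m} → CNF n m → Set
Unsatisfiable {n} φ = ¬ (∃ λ (a : Fin n → Bool) → Satisfies a φ)

record BipGraph : Set₁ where
  field
    nL nR : ℕ
    Adj   : Fin nL → Fin nR → Set

adjGraph : ∀ {n m} → CNF n m → BipGraph
adjGraph {n} {m} φ = record { nL = m ; nR = n ; Adj = Occurs φ }

b2n : Bool → ℕ
b2n true  = 1
b2n false = 0

sumFin : (k : ℕ) → (Fin k → ℕ) → ℕ
sumFin k f = sum (map f (allFin k))

module _ (G : BipGraph) where
  open BipGraph G

  Vertex : Set
  Vertex = Fin nL ⊎ Fin nR

  record Subgraph : Set where
    constructor subgraph
    field
      V : Vertex → Bool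
      E : Fin nL → Fin nR → Bool
  open Subgraph public

  WellFormed : Subgraph → Set
  WellFormed H = ∀ C x → E H C x ≡ true → V H (inj₁ C) ≡ true × V H (inj₂ x) ≡ true

  IsSubgraphOfG : Subgraph → Set
  IsSubgraphOfG F = WellFormed F × (∀ C x → E F C x ≡ true → Adj C x)

  _⊆ᵍ_ : Subgraph → Subgraph → Set
  H ⊆ᵍ F = (∀ v → V H v ≡ true → V F v ≡ true) × (∀ C x → E H C x ≡ true → E F C x ≡ true)

  data EdgeIn (F : Subgraph) : Vertex → Vertex → Set where
    lr : ∀ C x → E F C x ≡ true → EdgeIn F (inj₁ C) (inj₂ x)
    rl : ∀ C x → E F C x ≡ true → EdgeIn F (inj₂ x) (inj₁ C)

  Connected : Subgraph → Set
  Connected H = ∀ u v → V H u ≡ true → V H v ≡ true → Star (EdgeIn H) u v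

  IsComponent : Subgraph → Subgraph → Set
  IsComponent F H =
    WellFormed H × H ⊆ᵍ F × (∃ λ v → V H v ≡ true) × Connected H ×
    (∀ C x → E F C x ≡ true → (V H (inj₁ C) ≡ true ⊎ V H (inj₂ x) ≡ true) → E H C x ≡ true)

  countV : Subgraph → ℕ
  countV H = sumFin nL (λ C → b2n (V H (inj₁ C))) + sumFin nR (λ x → b2n (V H (inj₂ x)))

  countE : Subgraph → ℕ
  countE H = sumFin nL (λ C → sumFin nR (λ x → b2n (E H C x)))

  degL : Subgraph → Fin nL → ℕ
  degL F C = sumFin nR (λ x → b2n (E F C x))

  IsTree : Subgraph → Set
  IsTree H = Connected H × countE H + 1 ≡ countV H

  Is24Matching : Subgraph → Set
  Is24Matching F =
    IsSubgraphOfG F ×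
    (∀ H → IsComponent F H → IsTree H × countE H ≤ 4) ×
    (∀ C → V F (inj₁ C) ≡ true → degL F C ≡ 2)

  Covers : Subgraph → Vertex → Set
  Covers F v = V F v ≡ true

  emptySubgraph : Subgraph
  emptySubgraph = subgraph (λ _ → false) (λ _ _ → false)

  _∖ᵍ_ : Subgraph → Subgraph → Subgraph
  F ∖ᵍ H = subgraph (λ v → V F v ∧ not (V H v)) (λ C x → E F C x ∧ not (E H C x))

  FewerComponents : Subgraph → ℕ → Set
  FewerComponents F μ =
    ∃ λ (Hs : List Subgraph) → All (IsComponent F) Hs × length Hs < μ ×
      (∀ v → V F v ≡ true → Any (λ H → V H v ≡ true) Hs)

  KeepsComponents : Subgraph → Subgraph → Set
  KeepsComponents F F' = ∀ H → IsComponent F H → IsComponent F' H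

  -- Coverer wins CoverGame(G, μ): there is a set W of positions (the
  -- positions reachable when Coverer follows her strategy) containing the
  -- initial empty matching, consisting of (2,4)-matchings, closed under
  -- Chooser's removal moves, and such that every challenge in a position
  -- of W has an answer in W.
  CovererWins : ℕ → Set₁
  CovererWins μ =
    ∃ λ (W : Subgraph → Set) →
      W emptySubgraph ×
      (∀ F → W F → Is24Matching F) ×
      (∀ F H → W F → IsComponent F H → W (F ∖ᵍ H)) ×
      (∀ F → W F → FewerComponents F μ → ∀ v →
         ∃ λ F' → W F' × Is24Matching F' × Covers F' v × KeepsComponents F F')

module Alg {c ℓ : Level} (𝔽 : Field c ℓ) (n : ℕ) where
  open Field 𝔽 renaming (_+_ to _+F_; _*_ to _*F_)

  -- a monomial: exponent of x and exponent of x̄ for each x ∈ X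
  record Monomial : Set where
    constructor mon
    field
      ex eb : Fin n → ℕ
  open Monomial

  Term : Set c
  Term = Carrier × Monomial

  Polynomial : Set c
  Polynomial = List Term

  sameMon : Monomial → Monomial → Bool
  sameMon e e' = does (all? (λ i → ex e i ℕ.≟ ex e' i)) ∧ does (all? (λ i → eb e i ℕ.≟ eb e' i))

  coeff : Polynomial → Monomial → Carrier
  coeff [] e = 0#
  coeff ((a , e') ∷ p) e = if sameMon e' e then a +F coeff p e else coeff p e

  IsZeroPoly : Polynomial → Set ℓ
  IsZeroPoly p = ∀ e → coeff p e ≈ 0#

  -- partial assignments X → {0,1,⋆}; nothing = ⋆, just b = b
  PA : Set
  PA = Vec (Maybe Bool) n

  ⋆ : PA
  ⋆ = replicate n nothing

  InDom : PA → Fin n → Set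
  InDom α x = ∃ λ b → lookup α x ≡ just b

  fromBool : Bool → Carrier
  fromBool true  = 1#
  fromBool false = 0#

  pow : Carrier → ℕ → Carrier
  pow a zero    = 1#
  pow a (suc k) = a *F pow a k

  prodFin : (Fin n → Carrier) → Carrier
  prodFin f = foldr _*F_ 1# (map f (allFin n))

  -- substituting α (and α(x̄) = 1 - α(x)) into a term
  substFactor : Monomial → Maybe Bool → Fin n → Carrier
  substFactor e nothing  x = 1#
  substFactor e (just b) x = pow (fromBool b) (ex e x) *F pow (fromBool (not b)) (eb e x)

  keepExp : Maybe Bool → ℕ → ℕ
  keepExp nothing  k = k
  keepExp (just _) k = 0

  substTerm : PA → Term → Term
  substTerm α (a , e) =
    ( a *F prodFin (λ x → substFactor e (lookup α x) x)
    , mon (λ x → keepExp (lookup α x) (ex e x)) (λ x → keepExp (lookup α x) (eb e x)) )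

  _⊨_ : PA → Polynomial → Set ℓ
  α ⊨ p = IsZeroPoly (map (substTerm α) p)

  unitExp : Fin n → ℕ → Fin n → ℕ
  unitExp x k y = if does (x Fin.≟ y) then k else 0

  zeroMon : Monomial
  zeroMon = mon (λ _ → 0) (λ _ → 0)

  xMon x̄Mon : Fin n → ℕ → Monomial
  xMon x k = mon (unitExp x k) (λ _ → 0)
  x̄Mon x k = mon (λ _ → 0) (unitExp x k)

  mulMon : Monomial → Monomial → Monomial
  mulMon e e' = mon (λ y → ex e y + ex e' y) (λ y → eb e y + eb e' y)

  trLit : Literal n → Monomial
  trLit (x , true)  = x̄Mon x 1
  trLit (x , false) = xMon x 1

  trClause : Clause n → Polynomial
  trClause C = (1# , foldr mulMon zeroMon (map trLit C)) ∷ []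

  boolAxiom : Fin n → Polynomial
  boolAxiom x = (1# , xMon x 2) ∷ (- 1# , xMon x 1) ∷ []

  negAxiom : Fin n → Polynomial
  negAxiom x = (1# , xMon x 1) ∷ (1# , x̄Mon x 1) ∷ (- 1# , zeroMon) ∷ []

  tr : ∀ {m} → CNF n m → List Polynomial
  tr {m} φ = map (λ C → trClause (φ C)) (allFin m)
             ++ concatMap (λ x → boolAxiom x ∷ negAxiom x ∷ []) (allFin n)

  Factor : Set
  Factor = List PA

  FactorDom : Factor → Fin n → Set
  FactorDom H x = Any (λ α → InDom α x) H

  NonEmpty : Factor → Set
  NonEmpty H = ∃ λ α → α ∈ H

  SameSet : Factor → Factor → Set
  SameSet H H' = ∀ α → (α ∈ H → α ∈ H') × (α ∈ H' → α ∈ H)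

  isStarPA : ∀ {k} → Vec (Maybe Bool) k → Bool
  isStarPA Vec.[] = true
  isStarPA (just _ Vec.∷ v) = false
  isStarPA (nothing Vec.∷ v) = isStarPA v

  -- for a non-empty factor: H = {⋆}
  isStarFactor : Factor → Bool
  isStarFactor [] = true
  isStarFactor (α ∷ H) = isStarPA α ∧ isStarFactor H

  FlippableFactor : Factor → Set
  FlippableFactor H = ∀ x → FactorDom H x →
    ∃₂ λ α β → α ∈ H × β ∈ H × ∃ λ b → lookup α x ≡ just b × lookup β x ≡ just (not b)

  ProductFamily : Set
  ProductFamily = List Factor

  IsProductFamily : ProductFamily → Set
  IsProductFamily 𝓗 =
    All NonEmpty 𝓗 × AllPairs (λ H H' → ∀ x → FactorDom H x → FactorDom H' x → ⊥) 𝓗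

  IsFlippablePF : ProductFamily → Set
  IsFlippablePF 𝓗 = IsProductFamily 𝓗 × All FlippableFactor 𝓗

  _∪ₐ_ : PA → PA → PA
  α ∪ₐ β = zipWith pick α β
    where
      pick : Maybe Bool → Maybe Bool → Maybe Bool
      pick (just b) _ = just b
      pick nothing  m = m

  data _∈PF_ : PA → ProductFamily → Set where
    nil  : ⋆ ∈PF []
    cons : ∀ {H 𝓗 β γ} → β ∈ H → γ ∈PF 𝓗 → (β ∪ₐ γ) ∈PF (H ∷ 𝓗)

  rank : ProductFamily → ℕ
  rank [] = 0
  rank (H ∷ 𝓗) = if isStarFactor H then rank 𝓗 else suc (rank 𝓗)

  _⊑_ : ProductFamily → ProductFamily → Set
  𝓗' ⊑ 𝓗 = All (λ H' → T (isStarFactor H') ⊎ Any (SameSet H') 𝓗) 𝓗'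

  _⊨PF_ : ProductFamily → Polynomial → Set ℓ
  𝓗 ⊨PF p = ∀ α → α ∈PF 𝓗 → α ⊨ p

  IsWinningStrategy : ℕ → List Polynomial → (ProductFamily → Set) → Set (c ⊔ ℓ)
  IsWinningStrategy k P 𝓛 =
    (∃ λ 𝓗 → 𝓛 𝓗) ×
    (∀ 𝓗 → 𝓛 𝓗 → IsFlippablePF 𝓗) ×
    (∀ 𝓗 → 𝓛 𝓗 → ∀ 𝓗' → IsProductFamily 𝓗' → 𝓗' ⊑ 𝓗 → 𝓛 𝓗') ×
    (∀ 𝓗 → 𝓛 𝓗 → rank 𝓗 < k → All (λ p →
        ∃ λ 𝓗' → 𝓛 𝓗' × IsFlippablePF 𝓗' × 𝓗 ⊑ 𝓗' × 𝓗' ⊨PF p) P)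

  HasWinningStrategy : ℕ → List Polynomial → Set (lsuc Level.zero ⊔ c ⊔ ℓ)
  HasWinningStrategy k P = ∃ λ (𝓛 : ProductFamily → Set) → IsWinningStrategy k P 𝓛

module Submission where

-- A position F of Coverer's winning strategy (a (2,4)-matching of G_φ) gives the product-family
-- with one factor per component K of F: the restrictions to the variables of K of assignments
-- satisfying every clause of K through a literal on a variable of K. K is a tree with at most 4
-- edges in which clauses have degree 2, so it has c ≤ 2 clauses and c + 1 variables; the clauses
-- can therefore be satisfied on distinct variables avoiding any prescribed one, and each factor is
-- flippable. Every polynomial of tr(φ) belongs to a clause or a variable of φ and is forced by the
-- factor of a component containing that vertex; if there is none, Chooser challenges the vertex
-- and Coverer's answer supplies the component. Forgetting factors is Chooser removing components.

open import Defs
open import Level using (Level)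
import Algebra.Properties.Ring as RingProperties
open import Data.Bool using (Bool; true; false; not; _∧_; _∨_; if_then_else_; T)
open import Data.Bool.Properties using (∧-conicalˡ; ∧-conicalʳ; ∧-zeroʳ; ∧-identityʳ; ∨-zeroʳ; T-≡) renaming (_≟_ to _≟ᵇ_)
open import Data.Empty using (⊥; ⊥-elim)
open import Data.Fin using (Fin; zero; suc; _≟_)
import Data.Fin.Properties as Finₚ
open import Data.List using (List; []; _∷_; length; map; foldr; allFin; cartesianProductWith)
import Data.List as List
open import Data.List.Properties using (map-tabulate)
open import Data.List.Membership.Propositional using (_∈_; find; lose)
open import Data.List.Membership.Propositional.Properties using (∈-allFin; ∈-cartesianProductWith⁺; ∈-cartesianProductWith⁻)
open import Data.List.Relation.Unary.All using (All; []; _∷_)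
import Data.List.Relation.Unary.All as All
open import Data.List.Relation.Unary.All.Properties using (¬Any⇒All¬; ++⁺; map⁺; tabulate⁺; concat⁺)
open import Data.List.Relation.Unary.AllPairs using (AllPairs; []; _∷_)
open import Data.List.Relation.Unary.Any using (Any; here; there)
import Data.List.Relation.Unary.Any as Any
open import Data.Maybe using (Maybe; just; nothing)
open import Data.Nat using (ℕ; zero; suc; _+_; _*_; _≤_; _<_; z≤n; s≤s)
import Data.Nat as ℕ
open import Data.Nat.Induction using (<-wellFounded)
open import Data.Nat.ListAction using (sum)
open import Data.Nat.Properties
  using ( ≤-refl; ≤-reflexive; ≤-trans; ≤-antisym; m≤m+n; m≤n+m; m≤n⇒m≤1+n; <⇒≱; ≰⇒>; _≤?_
        ; +-mono-≤; +-mono-<; +-mono-<-≤; +-mono-≤-<; +-cancelˡ-≡; suc-injective; 0≢1+n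
        ; +-commutativeSemigroup; module ≤-Reasoning )
import Data.Nat.Properties as ℕₚ
open import Algebra.Properties.CommutativeSemigroup +-commutativeSemigroup using (interchange)
open import Data.Product using (Σ; ∃; ∃₂; _×_; _,_; proj₁; proj₂)
open import Data.Sum using (_⊎_; inj₁; inj₂)
import Data.Sum.Properties as Sumₚ
open import Data.Unit using (tt)
open import Data.Vec using (Vec; lookup; tabulate; zipWith)
import Data.Vec as Vec
open import Data.Vec.Properties using (lookup∘tabulate; lookup-zipWith)
open import Function using (_∘_; _$_; id; case_of_; mk⇔; Equivalence)
open import Induction.WellFounded using (Acc; acc)
open import Relation.Binary.Definitions using (DecidableEquality)
open import Relation.Binary.PropositionalEquality using (_≡_; _≢_; refl; sym; trans; cong; cong₂; subst; module ≡-Reasoning)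
open import Relation.Binary.Construct.Closure.ReflexiveTransitive using (Star; ε; _◅_; _◅◅_; reverse)
import Relation.Binary.Construct.Closure.ReflexiveTransitive as Star
import Relation.Binary.Reasoning.Setoid as SetoidReasoning
open import Relation.Nullary using (¬_; Dec; yes; no; does)
open import Relation.Nullary.Decidable using (_×-dec_; _⊎-dec_; map′; ¬?; decidable-stable; does-⇔)

false≢true : false ≢ true
false≢true ()

∧-intro : ∀ {a b} → a ≡ true → b ≡ true → a ∧ b ≡ true
∧-intro refl refl = refl

∨-introˡ : ∀ {a} b → a ≡ true → a ∨ b ≡ true
∨-introˡ b refl = refl

∨-introʳ : ∀ a {b} → b ≡ true → a ∨ b ≡ true
∨-introʳ a refl = ∨-zeroʳ a

∨-elim : ∀ a {b} → a ∨ b ≡ true → a ≡ true ⊎ b ≡ true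
∨-elim true  _ = inj₁ refl
∨-elim false e = inj₂ e

sumFin-suc : ∀ k (g : Fin (suc k) → ℕ) → sumFin (suc k) g ≡ g zero + sumFin k (g ∘ suc)
sumFin-suc k g = trans (as-tabulate (suc k) g) (cong (g zero +_) (sym (as-tabulate k (g ∘ suc))))
  where
  as-tabulate : ∀ k (g : Fin k → ℕ) → sumFin k g ≡ sum (List.tabulate g)
  as-tabulate k g = cong sum (map-tabulate id g)

sumFin-mono : ∀ k {g h : Fin k → ℕ} → (∀ i → g i ≤ h i) → sumFin k g ≤ sumFin k h
sumFin-mono zero    g≤h = z≤n
sumFin-mono (suc k) {g} {h} g≤h
  rewrite sumFin-suc k g | sumFin-suc k h = +-mono-≤ (g≤h zero) (sumFin-mono k (g≤h ∘ suc))

sumFin-cong : ∀ k {g h : Fin k → ℕ} → (∀ i → g i ≡ h i) → sumFin k g ≡ sumFin k h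
sumFin-cong k g≡h = ≤-antisym (sumFin-mono k (≤-reflexive ∘ g≡h)) (sumFin-mono k (≤-reflexive ∘ sym ∘ g≡h))

sumFin-mono-< : ∀ k {g h : Fin k → ℕ} → (∀ i → g i ≤ h i) → ∀ j → g j < h j → sumFin k g < sumFin k h
sumFin-mono-< (suc k) {g} {h} g≤h j gj<hj rewrite sumFin-suc k g | sumFin-suc k h with j
... | zero  = +-mono-<-≤ gj<hj (sumFin-mono k (g≤h ∘ suc))
... | suc j = +-mono-≤-< (g≤h zero) (sumFin-mono-< k (g≤h ∘ suc) j gj<hj)

sumFin-+ : ∀ k (g h : Fin k → ℕ) → sumFin k (λ i → g i + h i) ≡ sumFin k g + sumFin k h
sumFin-+ zero    g h = refl
sumFin-+ (suc k) g h = begin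
  sumFin (suc k) (λ i → g i + h i)
    ≡⟨ sumFin-suc k _ ⟩
  (g zero + h zero) + sumFin k (λ i → g (suc i) + h (suc i))
    ≡⟨ cong (g zero + h zero +_) (sumFin-+ k (g ∘ suc) (h ∘ suc)) ⟩
  (g zero + h zero) + (sumFin k (g ∘ suc) + sumFin k (h ∘ suc))
    ≡⟨ interchange (g zero) (h zero) _ _ ⟩
  (g zero + sumFin k (g ∘ suc)) + (h zero + sumFin k (h ∘ suc))
    ≡⟨ cong₂ _+_ (sumFin-suc k g) (sumFin-suc k h) ⟨
  sumFin (suc k) g + sumFin (suc k) h
    ∎
  where open ≡-Reasoning

sumFin-const : ∀ k a → sumFin k (λ _ → a) ≡ k * a
sumFin-const zero    a = refl
sumFin-const (suc k) a = trans (sumFin-suc k _) (cong (a +_) (sumFin-const k a))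

count : (k : ℕ) → (Fin k → Bool) → ℕ
count k f = sumFin k (b2n ∘ f)

b2n≤1 : ∀ b → b2n b ≤ 1
b2n≤1 false = z≤n
b2n≤1 true  = ≤-refl

b2n-mono : ∀ {a b} → (a ≡ true → b ≡ true) → b2n a ≤ b2n b
b2n-mono {false} a⇒b = z≤n
b2n-mono {true}  a⇒b rewrite a⇒b refl = ≤-refl

count-mono : ∀ k {f g : Fin k → Bool} → (∀ i → f i ≡ true → g i ≡ true) → count k f ≤ count k g
count-mono k f⊆g = sumFin-mono k (b2n-mono ∘ f⊆g)

count-mono-< : ∀ k {f g : Fin k → Bool} → (∀ i → f i ≡ true → g i ≡ true) →
               ∀ j → f j ≡ false → g j ≡ true → count k f < count k g
count-mono-< k f⊆g j fj gj = sumFin-mono-< k (b2n-mono ∘ f⊆g) j (b2n-< fj gj)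
  where
  b2n-< : ∀ {a b} → a ≡ false → b ≡ true → b2n a < b2n b
  b2n-< refl refl = s≤s z≤n

count≤size : ∀ k (f : Fin k → Bool) → count k f ≤ k
count≤size k f = begin
  count k f            ≤⟨ sumFin-mono k (b2n≤1 ∘ f) ⟩
  sumFin k (λ _ → 1)   ≡⟨ sumFin-const k 1 ⟩
  k * 1                ≡⟨ ℕₚ.*-identityʳ k ⟩
  k                    ∎
  where open ≤-Reasoning

count-none : ∀ k {f : Fin k → Bool} → (∀ i → f i ≢ true) → count k f ≡ 0
count-none k {f} none = trans (sumFin-cong k b2n≡0) (trans (sumFin-const k 0) (ℕₚ.*-zeroʳ k))
  where
  b2n≡0 : ∀ i → b2n (f i) ≡ 0
  b2n≡0 i with f i in fi
  ... | true  = ⊥-elim (none i fi)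
  ... | false = refl

_except_ : ∀ {k} → (Fin k → Bool) → Fin k → Fin k → Bool
(f except i) t = f t ∧ not (does (t ≟ i))

except-true : ∀ {k} {f : Fin k → Bool} {i t} → f t ≡ true → t ≢ i → (f except i) t ≡ true
except-true {i = i} {t} ft t≢i with t ≟ i
... | yes t≡i = ⊥-elim (t≢i t≡i)
... | no  _   rewrite ft = refl

except-true⁻ : ∀ {k} {f : Fin k → Bool} {i t} → (f except i) t ≡ true → f t ≡ true × t ≢ i
except-true⁻ {f = f} {i} {t} e with t ≟ i
... | yes _   rewrite ∧-zeroʳ (f t) = ⊥-elim (false≢true e)
... | no  t≢i rewrite ∧-identityʳ (f t) = e , t≢i

count-≟ : ∀ k (i : Fin k) → count k (λ t → does (t ≟ i)) ≡ 1
count-≟ (suc k) zero    = trans (sumFin-suc k (λ t → b2n (does (t ≟ zero)))) (cong suc (count-none k (λ _ ())))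
count-≟ (suc k) (suc i) = trans (sumFin-suc k (λ t → b2n (does (t ≟ suc i)))) (count-≟ k i)

count-remove : ∀ k {f : Fin k → Bool} {i} → f i ≡ true → count k f ≡ suc (count k (f except i))
count-remove k {f} {i} fi = begin
  count k f                                                   ≡⟨ sumFin-cong k split ⟩
  sumFin k (λ t → b2n (does (t ≟ i)) + b2n ((f except i) t)) ≡⟨ sumFin-+ k _ _ ⟩
  count k (λ t → does (t ≟ i)) + count k (f except i)         ≡⟨ cong (_+ count k (f except i)) (count-≟ k i) ⟩
  suc (count k (f except i))                                  ∎
  where
  open ≡-Reasoning
  split : ∀ t → b2n (f t) ≡ b2n (does (t ≟ i)) + b2n ((f except i) t)
  split t with t ≟ i
  ... | yes refl rewrite fi = refl
  ... | no  _    rewrite ∧-identityʳ (f t) = refl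

count≡0⇒none : ∀ k {f : Fin k → Bool} → count k f ≡ 0 → ∀ t → f t ≢ true
count≡0⇒none k c≡0 t ft = 0≢1+n (trans (sym c≡0) (count-remove k ft))

count-witness : ∀ k {f : Fin k → Bool} {c} → count k f ≡ suc c → ∃ λ i → f i ≡ true
count-witness k {f} c≡1+c with Finₚ.any? (λ i → f i ≟ᵇ true)
... | yes found = found
... | no  none  = ⊥-elim (0≢1+n (trans (sym (count-none k (λ i fi → none (i , fi)))) c≡1+c))

count≡1⇒single : ∀ k {f : Fin k → Bool} → count k f ≡ 1 →
                 ∃ λ i → f i ≡ true × (∀ t → f t ≡ true → t ≡ i)
count≡1⇒single k {f} c≡1 with count-witness k c≡1
... | i , fi = i , fi , only
  where
  only : ∀ t → f t ≡ true → t ≡ i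
  only t ft with t ≟ i
  ... | yes t≡i = t≡i
  ... | no  t≢i = ⊥-elim (count≡0⇒none k f∖i≡0 t (except-true {f = f} ft t≢i))
    where f∖i≡0 = suc-injective (trans (sym (count-remove k fi)) c≡1)

Exactly₂ : ∀ {k} → (Fin k → Bool) → Set
Exactly₂ f = ∃₂ λ i j → i ≢ j × f i ≡ true × f j ≡ true × (∀ t → f t ≡ true → t ≡ i ⊎ t ≡ j)

count≡2⇒exactly₂ : ∀ k {f : Fin k → Bool} → count k f ≡ 2 → Exactly₂ f
count≡2⇒exactly₂ k {f} c≡2 with count-witness k c≡2
... | i , fi with count≡1⇒single k (suc-injective (trans (sym (count-remove k fi)) c≡2))
... | j , f∖i-j , only-j with except-true⁻ {f = f} f∖i-j
... | fj , j≢i = i , j , j≢i ∘ sym , fi , fj , only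
  where
  only : ∀ t → f t ≡ true → t ≡ i ⊎ t ≡ j
  only t ft with t ≟ i
  ... | yes t≡i = inj₁ t≡i
  ... | no  t≢i = inj₂ (only-j t (except-true {f = f} ft t≢i))

count≤length : ∀ k {f : Fin k → Bool} (is : List (Fin k)) → (∀ t → f t ≡ true → t ∈ is) →
               count k f ≤ length is
count≤length k []       f⊆[] = ≤-reflexive (count-none k (λ t ft → case f⊆[] t ft of λ ()))
count≤length k {f} (i ∷ is) f⊆i∷is with f i in fi
... | true  = ≤-trans (≤-reflexive (count-remove k fi)) (s≤s (count≤length k is f∖i⊆is))
  where
  f∖i⊆is : ∀ t → (f except i) t ≡ true → t ∈ is
  f∖i⊆is t e with except-true⁻ {f = f} e
  ... | ft , t≢i with f⊆i∷is t ft
  ...   | here t≡i = ⊥-elim (t≢i t≡i)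
  ...   | there t∈is = t∈is
... | false = m≤n⇒m≤1+n (count≤length k is f⊆is)
  where
  f⊆is : ∀ t → f t ≡ true → t ∈ is
  f⊆is t ft with f⊆i∷is t ft
  ... | here refl = ⊥-elim (false≢true (trans (sym fi) ft))
  ... | there t∈is = t∈is

exactly₂-avoid : ∀ {k} {f : Fin k → Bool} → Exactly₂ f → ∀ z → ∃ λ p → f p ≡ true × p ≢ z
exactly₂-avoid (i , j , i≢j , fi , fj , _) z with i ≟ z
... | yes refl = j , fj , i≢j ∘ sym
... | no  i≢z  = i , fi , i≢z

exactly₂-outside : ∀ {k} {f g : Fin k → Bool} → Exactly₂ g → ¬ (∀ t → g t ≡ true → f t ≡ true) →
                   ∃ λ q → g q ≡ true × f q ≡ false
exactly₂-outside {f = f} (i , j , _ , gi , gj , only) g⊈f with f i in fi | f j in fj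
... | false | _     = i , gi , fi
... | true  | false = j , gj , fj
... | true  | true  = ⊥-elim (g⊈f g⊆f)
  where
  g⊆f : ∀ t → _ ≡ true → f t ≡ true
  g⊆f t gt with only t gt
  ... | inj₁ refl = fi
  ... | inj₂ refl = fj

exactly₂-representatives : ∀ {k} {f g : Fin k → Bool} → Exactly₂ f → Exactly₂ g →
                           ¬ (∀ t → g t ≡ true → f t ≡ true) → ∀ x →
                           ∃₂ λ p q → f p ≡ true × g q ≡ true × p ≢ x × q ≢ x × p ≢ q
exactly₂-representatives {f = f} {g} f₂ g₂ g⊈f x with f x in fx
... | true with exactly₂-avoid f₂ x | exactly₂-outside g₂ g⊈f
...   | p , fp , p≢x | q , gq , fq =
  p , q , fp , gq , p≢x , (λ { refl → false≢true (trans (sym fq) fx) }) ,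
  (λ { refl → false≢true (trans (sym fq) fp) })
exactly₂-representatives {f = f} {g} f₂ g₂ g⊈f x | false with exactly₂-avoid g₂ x
... | q , gq , q≢x with exactly₂-avoid f₂ q
...   | p , fp , p≢q =
  p , q , fp , gq , (λ { refl → false≢true (trans (sym fx) fp) }) , q≢x , p≢q

anyFin : ∀ k → (Fin k → Bool) → Bool
anyFin zero    p = false
anyFin (suc k) p = p zero ∨ anyFin k (p ∘ suc)

anyFin-intro : ∀ k {p : Fin k → Bool} i → p i ≡ true → anyFin k p ≡ true
anyFin-intro (suc k) {p} zero    pi = ∨-introˡ (anyFin k (p ∘ suc)) pi
anyFin-intro (suc k) {p} (suc i) pi = ∨-introʳ (p zero) (anyFin-intro k i pi)

anyFin-elim : ∀ k {p : Fin k → Bool} → anyFin k p ≡ true → ∃ λ i → p i ≡ true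
anyFin-elim (suc k) {p} e with ∨-elim (p zero) e
... | inj₁ p0 = zero , p0
... | inj₂ ps with anyFin-elim k ps
...   | i , pi = suc i , pi

-- Connected components

module Components (G : BipGraph) where
  open BipGraph G

  _≟ᵥ_ : DecidableEquality (Vertex G)
  _≟ᵥ_ = Sumₚ.≡-dec _≟_ _≟_

  anyVertex? : {P : Vertex G → Set} → (∀ v → Dec (P v)) → Dec (∃ P)
  anyVertex? {P} P? = map′ join split (Finₚ.any? (P? ∘ inj₁) ⊎-dec Finₚ.any? (P? ∘ inj₂))
    where
    join : ∃ (P ∘ inj₁) ⊎ ∃ (P ∘ inj₂) → ∃ P
    join (inj₁ (C , p)) = inj₁ C , p
    join (inj₂ (x , p)) = inj₂ x , p
    split : ∃ P → ∃ (P ∘ inj₁) ⊎ ∃ (P ∘ inj₂)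
    split (inj₁ C , p) = inj₁ (C , p)
    split (inj₂ x , p) = inj₂ (x , p)

  EdgeIn-sym : ∀ {F u v} → EdgeIn G F u v → EdgeIn G F v u
  EdgeIn-sym (lr C x e) = rl C x e
  EdgeIn-sym (rl C x e) = lr C x e

  VertexSet : Set
  VertexSet = Vertex G → Bool

  _⊆ᵥ_ : VertexSet → VertexSet → Set
  S ⊆ᵥ T = ∀ v → S v ≡ true → T v ≡ true

  size : VertexSet → ℕ
  size S = count nL (S ∘ inj₁) + count nR (S ∘ inj₂)

  size-mono-< : ∀ {S T} → S ⊆ᵥ T → ∀ v → S v ≡ false → T v ≡ true → size S < size T
  size-mono-< S⊆T (inj₁ C) Sv Tv =
    +-mono-<-≤ (count-mono-< nL (S⊆T ∘ inj₁) C Sv Tv) (count-mono nR (S⊆T ∘ inj₂))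
  size-mono-< S⊆T (inj₂ x) Sv Tv =
    +-mono-≤-< (count-mono nL (S⊆T ∘ inj₁)) (count-mono-< nR (S⊆T ∘ inj₂) x Sv Tv)

  size≤ : ∀ S → size S ≤ nL + nR
  size≤ S = +-mono-≤ (count≤size nL (S ∘ inj₁)) (count≤size nR (S ∘ inj₂))

  grow : Subgraph G → VertexSet → VertexSet
  grow F S (inj₁ C) = S (inj₁ C) ∨ anyFin nR (λ x → E F C x ∧ S (inj₂ x))
  grow F S (inj₂ x) = S (inj₂ x) ∨ anyFin nL (λ C → E F C x ∧ S (inj₁ C))

  grow-⊇ : ∀ F S → S ⊆ᵥ grow F S
  grow-⊇ F S (inj₁ C) Sv = ∨-introˡ _ Sv
  grow-⊇ F S (inj₂ x) Sv = ∨-introˡ _ Sv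

  grow-edge : ∀ F S {u v} → EdgeIn G F u v → S u ≡ true → grow F S v ≡ true
  grow-edge F S (lr C x e) Su = ∨-introʳ (S (inj₂ x)) (anyFin-intro nL C (∧-intro e Su))
  grow-edge F S (rl C x e) Su = ∨-introʳ (S (inj₁ C)) (anyFin-intro nR x (∧-intro e Su))

  grow-elim : ∀ F S v → grow F S v ≡ true → S v ≡ true ⊎ ∃ λ u → EdgeIn G F u v × S u ≡ true
  grow-elim F S (inj₁ C) e with ∨-elim (S (inj₁ C)) e
  ... | inj₁ Sv = inj₁ Sv
  ... | inj₂ a with anyFin-elim nR a
  ...   | x , ESx = inj₂ (inj₂ x , rl C x (∧-conicalˡ _ _ ESx) , ∧-conicalʳ _ _ ESx)
  grow-elim F S (inj₂ x) e with ∨-elim (S (inj₂ x)) e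
  ... | inj₁ Sv = inj₁ Sv
  ... | inj₂ a with anyFin-elim nL a
  ...   | C , ESC = inj₂ (inj₁ C , lr C x (∧-conicalˡ _ _ ESC) , ∧-conicalʳ _ _ ESC)

  grow-mono : ∀ F {S T} → S ⊆ᵥ T → grow F S ⊆ᵥ grow F T
  grow-mono F {S} {T} S⊆T v e with grow-elim F S v e
  ... | inj₁ Sv            = grow-⊇ F T v (S⊆T v Sv)
  ... | inj₂ (u , uv , Su) = grow-edge F T uv (S⊆T u Su)

  Stable : Subgraph G → VertexSet → Set
  Stable F S = grow F S ⊆ᵥ S

  stable-or-new : ∀ F S → Stable F S ⊎ ∃ λ v → grow F S v ≡ true × S v ≡ false
  stable-or-new F S with anyVertex? (λ v → (grow F S v ≟ᵇ true) ×-dec (S v ≟ᵇ false))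
  ... | yes new  = inj₂ new
  ... | no  ¬new = inj₁ stable
    where
    stable : Stable F S
    stable v gv with S v in Sv
    ... | true  = refl
    ... | false = ⊥-elim (¬new (v , gv , Sv))

  growⁿ : Subgraph G → VertexSet → ℕ → VertexSet
  growⁿ F S zero    = S
  growⁿ F S (suc k) = grow F (growⁿ F S k)

  -- each unstable step adds a vertex, and there are only nL + nR vertices
  growⁿ-stable-or-large : ∀ F S k → Stable F (growⁿ F S k) ⊎ k ≤ size (growⁿ F S k)
  growⁿ-stable-or-large F S zero = inj₂ z≤n
  growⁿ-stable-or-large F S (suc k) with stable-or-new F (growⁿ F S k) | growⁿ-stable-or-large F S k
  ... | inj₁ stable          | _            = inj₁ (λ v e → grow-⊇ F _ v (stable v (grow-mono F stable v e)))
  ... | inj₂ (v , gv , ¬Sv)  | inj₁ stable  = ⊥-elim (false≢true (trans (sym ¬Sv) (stable v gv)))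
  ... | inj₂ (v , gv , ¬Sv)  | inj₂ k≤size =
    inj₂ (≤-trans (s≤s k≤size) (size-mono-< (grow-⊇ F _) v ¬Sv gv))

  closure : Subgraph G → VertexSet → VertexSet
  closure F S = growⁿ F S (suc (nL + nR))

  closure-stable : ∀ F S → Stable F (closure F S)
  closure-stable F S with growⁿ-stable-or-large F S (suc (nL + nR))
  ... | inj₁ stable = stable
  ... | inj₂ large  = ⊥-elim (<⇒≱ large (size≤ (closure F S)))

  single : Vertex G → VertexSet
  single u v = does (v ≟ᵥ u)

  single-self : ∀ u → single u u ≡ true
  single-self u with u ≟ᵥ u
  ... | yes _   = refl
  ... | no  u≢u = ⊥-elim (u≢u refl)

  single-elim : ∀ {u v} → single u v ≡ true → v ≡ u
  single-elim {u} {v} e with v ≟ᵥ u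
  ... | yes v≡u = v≡u

  reach : Subgraph G → Vertex G → VertexSet
  reach F u = closure F (single u)

  growⁿ-⊇ : ∀ F S k → S ⊆ᵥ growⁿ F S k
  growⁿ-⊇ F S zero    v Sv = Sv
  growⁿ-⊇ F S (suc k) v Sv = grow-⊇ F _ v (growⁿ-⊇ F S k v Sv)

  reach-self : ∀ F u → reach F u u ≡ true
  reach-self F u = growⁿ-⊇ F (single u) (suc (nL + nR)) u (single-self u)

  reach-edge : ∀ F u {v w} → EdgeIn G F v w → reach F u v ≡ true → reach F u w ≡ true
  reach-edge F u {w = w} vw rv = closure-stable F (single u) w (grow-edge F (reach F u) vw rv)

  growⁿ⊆reach : ∀ F u k → growⁿ F (single u) k ⊆ᵥ reach F u
  growⁿ⊆reach F u zero    v e = subst (λ w → reach F u w ≡ true) (sym (single-elim {u} {v} e)) (reach-self F u)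
  growⁿ⊆reach F u (suc k) v e = closure-stable F (single u) v (grow-mono F (growⁿ⊆reach F u k) v e)

  componentOf : Subgraph G → Vertex G → Subgraph G
  componentOf F u = subgraph (reach F u) (λ C x → E F C x ∧ reach F u (inj₁ C))

  edge-in-componentOf : ∀ F u {v w} → EdgeIn G F v w → reach F u v ≡ true → reach F u w ≡ true →
                        EdgeIn G (componentOf F u) v w
  edge-in-componentOf F u (lr C x e) rC _  = lr C x (∧-intro e rC)
  edge-in-componentOf F u (rl C x e) _  rC = rl C x (∧-intro e rC)

  path-in-componentOf : ∀ F u k {v} → growⁿ F (single u) k v ≡ true → Star (EdgeIn G (componentOf F u)) u v
  path-in-componentOf F u zero    {v} e = subst (Star _ u) (sym (single-elim {u} {v} e)) ε
  path-in-componentOf F u (suc k) {v} e with grow-elim F _ v e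
  ... | inj₁ old           = path-in-componentOf F u k old
  ... | inj₂ (w , wv , Sw) =
    path-in-componentOf F u k Sw ◅◅
    (edge-in-componentOf F u wv (growⁿ⊆reach F u k w Sw) (growⁿ⊆reach F u (suc k) v e) ◅ ε)

  module _ (F : Subgraph G) (wf : WellFormed G F) (u : Vertex G) (u∈F : V F u ≡ true) where

    edge-target : ∀ {v w} → EdgeIn G F v w → V F w ≡ true
    edge-target (lr C x e) = proj₂ (wf C x e)
    edge-target (rl C x e) = proj₁ (wf C x e)

    growⁿ⊆V : ∀ k → growⁿ F (single u) k ⊆ᵥ V F
    growⁿ⊆V zero    v e = subst (λ w → V F w ≡ true) (sym (single-elim {u} {v} e)) u∈F
    growⁿ⊆V (suc k) v e with grow-elim F _ v e
    ... | inj₁ old         = growⁿ⊆V k v old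
    ... | inj₂ (_ , wv , _) = edge-target wv

    componentOf-isComponent : IsComponent G F (componentOf F u)
    componentOf-isComponent =
      wellFormed ,
      (growⁿ⊆V (suc (nL + nR)) , λ C x → ∧-conicalˡ _ _) ,
      (u , reach-self F u) ,
      (λ a b ra rb → reverse EdgeIn-sym (path-in-componentOf F u (suc (nL + nR)) ra) ◅◅
                      path-in-componentOf F u (suc (nL + nR)) rb) ,
      closed
      where
      wellFormed : WellFormed G (componentOf F u)
      wellFormed C x e = ∧-conicalʳ _ _ e , reach-edge F u (lr C x (∧-conicalˡ _ _ e)) (∧-conicalʳ _ _ e)
      closed : ∀ C x → E F C x ≡ true → reach F u (inj₁ C) ≡ true ⊎ reach F u (inj₂ x) ≡ true →
               E F C x ∧ reach F u (inj₁ C) ≡ true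
      closed C x e (inj₁ rC) = ∧-intro e rC
      closed C x e (inj₂ rx) = ∧-intro e (reach-edge F u (rl C x e) rx)

  module Component {F H : Subgraph G} (isComponent : IsComponent G F H) where
    wellFormed : WellFormed G H
    wellFormed = proj₁ isComponent

    V⊆ : ∀ v → V H v ≡ true → V F v ≡ true
    V⊆ = proj₁ (proj₁ (proj₂ isComponent))

    E⊆ : ∀ C x → E H C x ≡ true → E F C x ≡ true
    E⊆ = proj₂ (proj₁ (proj₂ isComponent))

    inhabited : ∃ λ v → V H v ≡ true
    inhabited = proj₁ (proj₂ (proj₂ isComponent))

    connected : Connected G H
    connected = proj₁ (proj₂ (proj₂ (proj₂ isComponent)))

    closed : ∀ C x → E F C x ≡ true → V H (inj₁ C) ≡ true ⊎ V H (inj₂ x) ≡ true → E H C x ≡ true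
    closed = proj₂ (proj₂ (proj₂ (proj₂ isComponent)))

    edge-closed : ∀ {a b} → EdgeIn G F a b → V H a ≡ true → V H b ≡ true
    edge-closed (lr C x e) Ha = proj₂ (wellFormed C x (closed C x e (inj₁ Ha)))
    edge-closed (rl C x e) Ha = proj₁ (wellFormed C x (closed C x e (inj₂ Ha)))

    path-closed : ∀ {a b} → Star (EdgeIn G F) a b → V H a ≡ true → V H b ≡ true
    path-closed ε        Ha = Ha
    path-closed (e ◅ es) Ha = path-closed es (edge-closed e Ha)

    edge-⊆ : ∀ {a b} → EdgeIn G H a b → EdgeIn G F a b
    edge-⊆ (lr C x e) = lr C x (E⊆ C x e)
    edge-⊆ (rl C x e) = rl C x (E⊆ C x e)

  components-overlap : ∀ {F H K} → IsComponent G F H → IsComponent G F K →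
                       ∀ a → V H a ≡ true → V K a ≡ true → ∀ b → V K b ≡ true → V H b ≡ true
  components-overlap cH cK a Ha Ka b Kb =
    Component.path-closed cH (Star.map (Component.edge-⊆ cK) (Component.connected cK a b Ka Kb)) Ha

  component-∖ᵍ : ∀ {F H K} → IsComponent G F H → IsComponent G F K →
                 (∀ v → V H v ≡ true → V K v ≡ true → ⊥) → IsComponent G (_∖ᵍ_ G F K) H
  component-∖ᵍ {F} {H} {K} cH cK disjoint =
    wellFormed , (V⊆′ , E⊆′) , inhabited , connected , λ C x e → closed C x (∧-conicalˡ _ _ e)
    where
    open Component cH
    V⊆′ : ∀ v → V H v ≡ true → V F v ∧ not (V K v) ≡ true
    V⊆′ v Hv with V K v in Kv
    ... | true  = ⊥-elim (disjoint v Hv Kv)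
    ... | false = ∧-intro (V⊆ v Hv) refl
    E⊆′ : ∀ C x → E H C x ≡ true → E F C x ∧ not (E K C x) ≡ true
    E⊆′ C x e with E K C x in eK
    ... | true  = ⊥-elim (disjoint (inj₁ C) (proj₁ (wellFormed C x e)) (proj₁ (Component.wellFormed cK C x eK)))
    ... | false = ∧-intro (E⊆ C x e) refl

  Covered : List (Subgraph G) → Vertex G → Set
  Covered Hs v = Any (λ H → V H v ≡ true) Hs

  covered? : ∀ Hs v → Dec (Covered Hs v)
  covered? Hs v = Any.any? (λ H → V H v ≟ᵇ true) Hs

  module Pruning (W : Subgraph G → Set) (W-wellFormed : ∀ F → W F → WellFormed G F)
                 (W-∖ᵍ : ∀ F H → W F → IsComponent G F H → W (_∖ᵍ_ G F H)) where

    Pruned : List (Subgraph G) → Set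
    Pruned Hs = ∃ λ F₀ → W F₀ × All (IsComponent G F₀) Hs × (∀ v → V F₀ v ≡ true → Covered Hs v)

    -- F₀ is F with its components outside Hs removed one at a time
    prune : ∀ F Hs → W F → All (IsComponent G F) Hs → Pruned Hs
    prune F Hs = go F (<-wellFounded (size (V F)))
      where
      go : ∀ F → Acc _<_ (size (V F)) → W F → All (IsComponent G F) Hs → Pruned Hs
      go F (acc smaller) wF cHs with anyVertex? (λ v → (V F v ≟ᵇ true) ×-dec ¬? (covered? Hs v))
      ... | no ¬uncovered =
        F , wF , cHs , λ v Fv → decidable-stable (covered? Hs v) (λ ¬cv → ¬uncovered (v , Fv , ¬cv))
      ... | yes (u , Fu , ¬cu) =
        go (_∖ᵍ_ G F K) (smaller shrinks) (W-∖ᵍ F K wF cK) (All.zipWith keep (cHs , ¬Any⇒All¬ Hs ¬cu))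
        where
        K = componentOf F u
        cK : IsComponent G F K
        cK = componentOf-isComponent F (W-wellFormed F wF) u Fu
        keep : ∀ {H} → IsComponent G F H × ¬ (V H u ≡ true) → IsComponent G (_∖ᵍ_ G F K) H
        keep (cH , ¬Hu) = component-∖ᵍ cH cK
          (λ v Hv Kv → ¬Hu (components-overlap cH cK v Hv Kv u (reach-self F u)))
        u∉F∖K : V F u ∧ not (reach F u u) ≡ false
        u∉F∖K rewrite reach-self F u = ∧-zeroʳ (V F u)
        shrinks : size (V (_∖ᵍ_ G F K)) < size (V F)
        shrinks = size-mono-< {V (_∖ᵍ_ G F K)} {V F} (λ v → ∧-conicalˡ (V F v) _) u u∉F∖K Fu

-- Evaluating tr(φ) under partial assignments

module Evaluation {c ℓ : Level} (𝔽 : Field c ℓ) (n : ℕ) where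
  open Alg 𝔽 n
  open Field 𝔽 hiding (zero) renaming (_+_ to _+F_; _*_ to _*F_; refl to ≈-refl; sym to ≈-sym; trans to ≈-trans)
  open RingProperties ring using (-1*x≈-x)
  open SetoidReasoning setoid
  open Monomial

  ∏ : (k : ℕ) → (Fin k → Carrier) → Carrier
  ∏ k f = foldr _*F_ 1# (map f (allFin k))

  ∏-suc : ∀ k (f : Fin (suc k) → Carrier) → ∏ (suc k) f ≡ f zero *F ∏ k (f ∘ suc)
  ∏-suc k f = trans (as-tabulate (suc k) f) (cong (f zero *F_) (sym (as-tabulate k (f ∘ suc))))
    where
    as-tabulate : ∀ k (f : Fin k → Carrier) → ∏ k f ≡ foldr _*F_ 1# (List.tabulate f)
    as-tabulate k f = cong (foldr _*F_ 1#) (map-tabulate id f)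

  ∏-≈1 : ∀ k (f : Fin k → Carrier) → (∀ y → f y ≈ 1#) → ∏ k f ≈ 1#
  ∏-≈1 zero    f f≈1 = ≈-refl
  ∏-≈1 (suc k) f f≈1 rewrite ∏-suc k f =
    ≈-trans (*-cong (f≈1 zero) (∏-≈1 k (f ∘ suc) (f≈1 ∘ suc))) (*-identityˡ 1#)

  ∏-≈0 : ∀ k (f : Fin k → Carrier) y → f y ≈ 0# → ∏ k f ≈ 0#
  ∏-≈0 (suc k) f zero    fy≈0 rewrite ∏-suc k f = ≈-trans (*-cong fy≈0 ≈-refl) (zeroˡ _)
  ∏-≈0 (suc k) f (suc y) fy≈0 rewrite ∏-suc k f =
    ≈-trans (*-cong ≈-refl (∏-≈0 k (f ∘ suc) y fy≈0)) (zeroʳ _)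

  ∏-single : ∀ k (f : Fin k → Carrier) x → (∀ y → y ≢ x → f y ≈ 1#) → ∏ k f ≈ f x
  ∏-single (suc k) f zero    others rewrite ∏-suc k f =
    ≈-trans (*-cong ≈-refl (∏-≈1 k (f ∘ suc) (λ y → others (suc y) λ ()))) (*-identityʳ _)
  ∏-single (suc k) f (suc x) others rewrite ∏-suc k f =
    ≈-trans (*-cong (others zero λ ()) (∏-single k (f ∘ suc) x (λ y y≢x → others (suc y) (y≢x ∘ Finₚ.suc-injective))))
            (*-identityˡ _)

  sumCoeffs : Polynomial → Carrier
  sumCoeffs = foldr (λ t s → proj₁ t +F s) 0#

  coeff-match : ∀ p e → All (λ t → sameMon (proj₂ t) e ≡ true) p → coeff p e ≡ sumCoeffs p
  coeff-match []            e []         = refl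
  coeff-match ((a , m) ∷ p) e (me ∷ mes) rewrite me = cong (a +F_) (coeff-match p e mes)

  coeff-mismatch : ∀ p e → All (λ t → sameMon (proj₂ t) e ≡ false) p → coeff p e ≡ 0#
  coeff-mismatch []            e []         = refl
  coeff-mismatch ((a , m) ∷ p) e (me ∷ mes) rewrite me = coeff-mismatch p e mes

  coeff-zeroCoeffs : ∀ p e → All (λ t → proj₁ t ≈ 0#) p → coeff p e ≈ 0#
  coeff-zeroCoeffs []            e []         = ≈-refl
  coeff-zeroCoeffs ((a , m) ∷ p) e (a≈0 ∷ ps) with sameMon m e
  ... | true  = ≈-trans (+-cong a≈0 (coeff-zeroCoeffs p e ps)) (+-identityˡ 0#)
  ... | false = coeff-zeroCoeffs p e ps

  IsConstant : Monomial → Set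
  IsConstant m = ∀ y → ex m y ≡ 0 × eb m y ≡ 0

  sameMon-constant : ∀ {m} → IsConstant m → ∀ e → sameMon m e ≡ sameMon zeroMon e
  sameMon-constant {m} m-const e =
    cong₂ _∧_ (same ex (proj₁ ∘ m-const) (λ _ → refl)) (same eb (proj₂ ∘ m-const) (λ _ → refl))
    where
    same : (exp : Monomial → Fin n → ℕ) → (∀ i → exp m i ≡ 0) → (∀ i → exp zeroMon i ≡ 0) →
           does (Finₚ.all? λ i → exp m i ℕ.≟ exp e i) ≡ does (Finₚ.all? λ i → exp zeroMon i ℕ.≟ exp e i)
    same exp m≡0 z≡0 = does-⇔ (mk⇔ (λ p i → trans (z≡0 i) (trans (sym (m≡0 i)) (p i)))
                                   (λ p i → trans (m≡0 i) (trans (sym (z≡0 i)) (p i))))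
                              (Finₚ.all? λ i → exp m i ℕ.≟ exp e i) (Finₚ.all? λ i → exp zeroMon i ℕ.≟ exp e i)

  ⊨-constant : ∀ α p → All (IsConstant ∘ proj₂) (map (substTerm α) p) →
               sumCoeffs (map (substTerm α) p) ≈ 0# → α ⊨ p
  ⊨-constant α p consts sum≈0 e with sameMon zeroMon e in z
  ... | true  = ≈-trans (reflexive (coeff-match _ e (All.map (λ c → trans (sameMon-constant c e) z) consts))) sum≈0
  ... | false = reflexive (coeff-mismatch _ e (All.map (λ c → trans (sameMon-constant c e) z) consts))

  unitExp-self : ∀ x k → unitExp x k x ≡ k
  unitExp-self x k with x ≟ x
  ... | yes _   = refl
  ... | no  x≢x = ⊥-elim (x≢x refl)

  unitExp-other : ∀ x k y → y ≢ x → unitExp x k y ≡ 0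
  unitExp-other x k y y≢x with x ≟ y
  ... | yes x≡y = ⊥-elim (y≢x (sym x≡y))
  ... | no  _   = refl

  SupportedOn : Monomial → Fin n → Set
  SupportedOn m x = ∀ y → y ≢ x → ex m y ≡ 0 × eb m y ≡ 0

  xMon-supported : ∀ x k → SupportedOn (xMon x k) x
  xMon-supported x k y y≢x = unitExp-other x k y y≢x , refl

  x̄Mon-supported : ∀ x k → SupportedOn (x̄Mon x k) x
  x̄Mon-supported x k y y≢x = refl , unitExp-other x k y y≢x

  keepExp-zero : ∀ a → keepExp a 0 ≡ 0
  keepExp-zero nothing  = refl
  keepExp-zero (just _) = refl

  substMon-constant : ∀ α x {b} → lookup α x ≡ just b → ∀ {m} → SupportedOn m x → ∀ a →
                      IsConstant (proj₂ (substTerm α (a , m)))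
  substMon-constant α x αx {m} supp a y with y ≟ x
  ... | yes refl rewrite αx = refl , refl
  ... | no  y≢x rewrite proj₁ (supp y y≢x) | proj₂ (supp y y≢x) =
    keepExp-zero (lookup α y) , keepExp-zero (lookup α y)

  -- substTerm α (a , m) has coefficient a *F value α m
  value : PA → Monomial → Carrier
  value α m = ∏ n (λ y → substFactor m (lookup α y) y)

  substFactor-unused : ∀ m a y → ex m y ≡ 0 → eb m y ≡ 0 → substFactor m a y ≈ 1#
  substFactor-unused m nothing  y _    _    = ≈-refl
  substFactor-unused m (just b) y ex≡0 eb≡0 rewrite ex≡0 | eb≡0 = *-identityˡ 1#

  value-supported : ∀ α x {b} → lookup α x ≡ just b → ∀ {m} → SupportedOn m x →
                    value α m ≈ pow (fromBool b) (ex m x) *F pow (fromBool (not b)) (eb m x)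
  value-supported α x αx {m} supp =
    ≈-trans (∏-single n _ x (λ y y≢x → substFactor-unused m (lookup α y) y (proj₁ (supp y y≢x)) (proj₂ (supp y y≢x))))
            (reflexive (cong (λ a → substFactor m a x) αx))

  pow-fromBool : ∀ b k → 1 ≤ k → pow (fromBool b) k ≈ fromBool b
  pow-fromBool true  (suc zero)    _ = *-identityʳ 1#
  pow-fromBool true  (suc (suc k)) _ = ≈-trans (*-identityˡ _) (pow-fromBool true (suc k) (s≤s z≤n))
  pow-fromBool false (suc k)       _ = zeroˡ _

  value-xMon : ∀ α x {b} → lookup α x ≡ just b → ∀ k → 1 ≤ k → value α (xMon x k) ≈ fromBool b
  value-xMon α x {b} αx k 1≤k = begin
    value α (xMon x k)                  ≈⟨ value-supported α x αx (xMon-supported x k) ⟩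
    pow (fromBool b) (unitExp x k x) *F 1# ≈⟨ *-identityʳ _ ⟩
    pow (fromBool b) (unitExp x k x)    ≡⟨ cong (pow (fromBool b)) (unitExp-self x k) ⟩
    pow (fromBool b) k                  ≈⟨ pow-fromBool b k 1≤k ⟩
    fromBool b                          ∎

  value-x̄Mon : ∀ α x {b} → lookup α x ≡ just b → ∀ k → 1 ≤ k → value α (x̄Mon x k) ≈ fromBool (not b)
  value-x̄Mon α x {b} αx k 1≤k = begin
    value α (x̄Mon x k)                        ≈⟨ value-supported α x αx (x̄Mon-supported x k) ⟩
    1# *F pow (fromBool (not b)) (unitExp x k x) ≈⟨ *-identityˡ _ ⟩
    pow (fromBool (not b)) (unitExp x k x)    ≡⟨ cong (pow (fromBool (not b))) (unitExp-self x k) ⟩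
    pow (fromBool (not b)) k                  ≈⟨ pow-fromBool (not b) k 1≤k ⟩
    fromBool (not b)                          ∎

  value-zeroMon : ∀ α → value α zeroMon ≈ 1#
  value-zeroMon α = ∏-≈1 n _ (λ y → substFactor-unused zeroMon (lookup α y) y refl refl)

  fromBool-+-not : ∀ b → fromBool b +F fromBool (not b) ≈ 1#
  fromBool-+-not true  = +-identityʳ 1#
  fromBool-+-not false = +-identityˡ 1#

  boolAxiom-sound : ∀ α x → InDom α x → α ⊨ boolAxiom x
  boolAxiom-sound α x (b , αx) =
    ⊨-constant α (boolAxiom x)
      (substMon-constant α x αx (xMon-supported x 2) 1# ∷ substMon-constant α x αx (xMon-supported x 1) (- 1#) ∷ [])
      (begin
        1# *F value α (xMon x 2) +F (- 1# *F value α (xMon x 1) +F 0#)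
          ≈⟨ +-cong (*-identityˡ _) (≈-trans (+-identityʳ _) (-1*x≈-x _)) ⟩
        value α (xMon x 2) +F - value α (xMon x 1)
          ≈⟨ +-cong (value-xMon α x αx 2 (s≤s z≤n)) (-‿cong (value-xMon α x αx 1 (s≤s z≤n))) ⟩
        fromBool b +F - fromBool b
          ≈⟨ -‿inverseʳ _ ⟩
        0# ∎)

  negAxiom-sound : ∀ α x → InDom α x → α ⊨ negAxiom x
  negAxiom-sound α x (b , αx) =
    ⊨-constant α (negAxiom x)
      (substMon-constant α x αx (xMon-supported x 1) 1# ∷ substMon-constant α x αx (x̄Mon-supported x 1) 1# ∷
       substMon-constant α x αx {zeroMon} (λ _ _ → refl , refl) (- 1#) ∷ [])
      (begin
        1# *F value α (xMon x 1) +F (1# *F value α (x̄Mon x 1) +F (- 1# *F value α zeroMon +F 0#))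
          ≈⟨ +-cong (*-identityˡ _) (+-cong (*-identityˡ _) (≈-trans (+-identityʳ _) (-1*x≈-x _))) ⟩
        value α (xMon x 1) +F (value α (x̄Mon x 1) +F - value α zeroMon)
          ≈⟨ +-cong (value-xMon α x αx 1 (s≤s z≤n))
                    (+-cong (value-x̄Mon α x αx 1 (s≤s z≤n)) (-‿cong (value-zeroMon α))) ⟩
        fromBool b +F (fromBool (not b) +F - 1#)
          ≈⟨ ≈-sym (+-assoc _ _ _) ⟩
        (fromBool b +F fromBool (not b)) +F - 1#
          ≈⟨ +-cong (fromBool-+-not b) ≈-refl ⟩
        1# +F - 1#
          ≈⟨ -‿inverseʳ _ ⟩
        0# ∎)

  clauseMon : Clause n → Monomial
  clauseMon C = foldr mulMon zeroMon (map trLit C)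

  -- the exponent of the factor of tr(C) that vanishes when the literal (y , b) is true
  vanishingExp : Bool → Monomial → Fin n → ℕ
  vanishingExp b m y = if b then eb m y else ex m y

  literal-vanishingExp : ∀ {C y b} → (y , b) ∈ C → 1 ≤ vanishingExp b (clauseMon C) y
  literal-vanishingExp {_ ∷ C} {y} {true}  (here refl) =
    ≤-trans (≤-reflexive (sym (unitExp-self y 1))) (m≤m+n _ (eb (clauseMon C) y))
  literal-vanishingExp {_ ∷ C} {y} {false} (here refl) =
    ≤-trans (≤-reflexive (sym (unitExp-self y 1))) (m≤m+n _ (ex (clauseMon C) y))
  literal-vanishingExp {l ∷ C} {b = true}  (there y∈C) = ≤-trans (literal-vanishingExp y∈C) (m≤n+m _ _)
  literal-vanishingExp {l ∷ C} {b = false} (there y∈C) = ≤-trans (literal-vanishingExp y∈C) (m≤n+m _ _)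

  substFactor-vanishes : ∀ m y b → 1 ≤ vanishingExp b m y → substFactor m (just b) y ≈ 0#
  substFactor-vanishes m y true  1≤e with eb m y
  ... | suc k = ≈-trans (*-cong ≈-refl (zeroˡ _)) (zeroʳ _)
  substFactor-vanishes m y false 1≤e with ex m y
  ... | suc k = ≈-trans (*-cong (zeroˡ _) ≈-refl) (zeroˡ _)

  clause-sound : ∀ α C → Any (λ l → lookup α (proj₁ l) ≡ just (proj₂ l)) C → α ⊨ trClause C
  clause-sound α C sat e with find sat
  ... | (y , b) , l∈C , αy =
    coeff-zeroCoeffs _ e (≈-trans (*-identityˡ _) (∏-≈0 n _ y vanishes) ∷ [])
    where
    vanishes : substFactor (clauseMon C) (lookup α y) y ≈ 0#
    vanishes rewrite αy = substFactor-vanishes (clauseMon C) y b (literal-vanishingExp l∈C)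

-- Product-families

module ProductFamilies {c ℓ} (𝔽 : Field c ℓ) (n : ℕ) where
  open Alg 𝔽 n

  isStarPA-lookup : ∀ {k} (α : Vec (Maybe Bool) k) → isStarPA α ≡ true → ∀ x → lookup α x ≡ nothing
  isStarPA-lookup (nothing Vec.∷ α) e zero    = refl
  isStarPA-lookup (nothing Vec.∷ α) e (suc x) = isStarPA-lookup α e x

  assigned⇒¬isStarPA : ∀ {k} (α : Vec (Maybe Bool) k) x {b} → lookup α x ≡ just b → isStarPA α ≡ false
  assigned⇒¬isStarPA (just _  Vec.∷ α) x       e = refl
  assigned⇒¬isStarPA (nothing Vec.∷ α) (suc x) e = assigned⇒¬isStarPA α x e

  isStarFactor-elements : ∀ H → T (isStarFactor H) → ∀ {α} → α ∈ H → isStarPA α ≡ true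
  isStarFactor-elements (β ∷ H) t (here refl) with isStarPA β
  ... | true = refl
  isStarFactor-elements (β ∷ H) t (there α∈H) with isStarPA β
  ... | true = isStarFactor-elements H t α∈H

  ¬isStarFactor : ∀ {H α} → α ∈ H → isStarPA α ≡ false → isStarFactor H ≡ false
  ¬isStarFactor (here refl) e rewrite e = refl
  ¬isStarFactor {β ∷ H} (there α∈H) e rewrite ¬isStarFactor α∈H e = ∧-zeroʳ (isStarPA β)

  ¬isStarFactor-witness : ∀ H → isStarFactor H ≡ false → ∃ λ α → α ∈ H × isStarPA α ≡ false
  ¬isStarFactor-witness (β ∷ H) e with isStarPA β in β⋆
  ... | false = β , here refl , β⋆
  ... | true with ¬isStarFactor-witness H e
  ...   | α , α∈H , α⋆ = α , there α∈H , α⋆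

  isStarFactor-domain : ∀ H → T (isStarFactor H) → ∀ x → ¬ FactorDom H x
  isStarFactor-domain H t x x∈dom with find x∈dom
  ... | α , α∈H , b , αx with trans (sym (isStarPA-lookup α (isStarFactor-elements H t α∈H) x)) αx
  ...   | ()

  SameSet-refl : ∀ H → SameSet H H
  SameSet-refl H α = id , id

  SameSet-domain : ∀ {H H′} → SameSet H H′ → ∀ x → FactorDom H x → FactorDom H′ x
  SameSet-domain H≈H′ x x∈dom with find x∈dom
  ... | α , α∈H , x∈α = lose (proj₁ (H≈H′ α) α∈H) x∈α

  SameSet-flippable : ∀ {H H′} → SameSet H H′ → FlippableFactor H′ → FlippableFactor H
  SameSet-flippable H≈H′ flippable x x∈dom with flippable x (SameSet-domain H≈H′ x x∈dom)
  ... | α , β , α∈ , β∈ , flips = α , β , proj₂ (H≈H′ α) α∈ , proj₂ (H≈H′ β) β∈ , flips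

  SameSet-¬isStarFactor : ∀ {H H′} → SameSet H H′ → isStarFactor H ≡ false → isStarFactor H′ ≡ false
  SameSet-¬isStarFactor {H} H≈H′ e with ¬isStarFactor-witness H e
  ... | α , α∈H , α⋆ = ¬isStarFactor (proj₁ (H≈H′ α) α∈H) α⋆

  ⊑-⊆ : ∀ {𝓗 𝓗′} → (∀ {H} → H ∈ 𝓗 → H ∈ 𝓗′) → 𝓗 ⊑ 𝓗′
  ⊑-⊆ 𝓗⊆𝓗′ = All.tabulate (λ {H} H∈𝓗 → inj₂ (lose (𝓗⊆𝓗′ H∈𝓗) (SameSet-refl H)))

  _extends_ : PA → PA → Set
  α extends β = ∀ x {b} → lookup β x ≡ just b → lookup α x ≡ just b

  -- the combining function of _∪ₐ_ is local to its definition, so it is only described by its behaviour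
  ∪ₐ-zipWith : ∀ β γ → Σ (Maybe Bool → Maybe Bool → Maybe Bool) λ f →
               β ∪ₐ γ ≡ zipWith f β γ × (∀ b a → f (just b) a ≡ just b) × (∀ a → f nothing a ≡ a)
  ∪ₐ-zipWith β γ = _ , refl , (λ _ _ → refl) , λ _ → refl

  ∪ₐ-extendsˡ : ∀ β γ → (β ∪ₐ γ) extends β
  ∪ₐ-extendsˡ β γ x {b} βx with ∪ₐ-zipWith β γ
  ... | f , ∪≡zip , f-just , _ = subst (λ α → lookup α x ≡ just b) (sym ∪≡zip)
    (trans (lookup-zipWith f x β γ) (trans (cong (λ a → f a (lookup γ x)) βx) (f-just b _)))

  ∪ₐ-extendsʳ : ∀ β γ {δ} → γ extends δ → (∀ x {b} → lookup δ x ≡ just b → lookup β x ≡ nothing) →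
                (β ∪ₐ γ) extends δ
  ∪ₐ-extendsʳ β γ γ⊇δ β∩δ≡∅ x {b} δx with ∪ₐ-zipWith β γ
  ... | f , ∪≡zip , _ , f-nothing = subst (λ α → lookup α x ≡ just b) (sym ∪≡zip) $
    trans (lookup-zipWith f x β γ) $
    trans (cong (λ a → f a (lookup γ x)) (β∩δ≡∅ x δx)) (trans (f-nothing _) (γ⊇δ x δx))

  ∈PF-extends : ∀ {𝓗 α} → IsProductFamily 𝓗 → α ∈PF 𝓗 → ∀ {H} → H ∈ 𝓗 →
                ∃ λ β → β ∈ H × α extends β
  ∈PF-extends _ (cons {β = β} {γ} β∈H γ∈𝓗) (here refl) = β , β∈H , ∪ₐ-extendsˡ β γ
  ∈PF-extends (_ ∷ nonEmpty , disjoint ∷ pairs) (cons {β = β} {γ} β∈H₀ γ∈𝓗) (there H∈𝓗)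
    with ∈PF-extends (nonEmpty , pairs) γ∈𝓗 H∈𝓗
  ... | δ , δ∈H , γ⊇δ = δ , δ∈H , ∪ₐ-extendsʳ β γ {δ} γ⊇δ β∩δ≡∅
    where
    β∩δ≡∅ : ∀ x {b} → lookup δ x ≡ just b → lookup β x ≡ nothing
    β∩δ≡∅ x {b} δx with lookup β x in βx
    ... | nothing = refl
    ... | just b′ = ⊥-elim (All.lookup disjoint H∈𝓗 x (lose β∈H₀ (b′ , βx)) (lose δ∈H (b , δx)))

-- Satisfying the clauses of a component

assignLiterals : ∀ {n} → List (Literal n) → Bool → Fin n → Bool
assignLiterals []             c t = c
assignLiterals ((y , b) ∷ ls) c t = if does (t ≟ y) then b else assignLiterals ls c t

assignLiterals-default : ∀ {n} (ls : List (Literal n)) c {t} → All (λ l → proj₁ l ≢ t) ls →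
                         assignLiterals ls c t ≡ c
assignLiterals-default []             c []             = refl
assignLiterals-default ((y , b) ∷ ls) c {t} (y≢t ∷ ls≢t) with t ≟ y
... | yes refl = ⊥-elim (y≢t refl)
... | no  _    = assignLiterals-default ls c ls≢t

assignLiterals-literal : ∀ {n} (ls : List (Literal n)) c → AllPairs (λ l l′ → proj₁ l ≢ proj₁ l′) ls →
                         ∀ {l} → l ∈ ls → assignLiterals ls c (proj₁ l) ≡ proj₂ l
assignLiterals-literal ((y , b) ∷ ls) c _ (here refl) with y ≟ y
... | yes _   = refl
... | no  y≢y = ⊥-elim (y≢y refl)
assignLiterals-literal ((y , b) ∷ ls) c (y≢ls ∷ distinct) {l} (there l∈ls) with proj₁ l ≟ y
... | yes refl = ⊥-elim (All.lookup y≢ls l∈ls refl)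
... | no  _    = assignLiterals-literal ls c distinct l∈ls

module ComponentAssignments {n m : ℕ} (φ : CNF n m) where
  G : BipGraph
  G = adjGraph φ
  open Components G

  SatisfiesWithin : Subgraph G → Vec Bool n → Set
  SatisfiesWithin K w = ∀ C → V K (inj₁ C) ≡ true →
    Any (λ l → V K (inj₂ (proj₁ l)) ≡ true × lookup w (proj₁ l) ≡ proj₂ l) (φ C)

  literalOn : ∀ F → IsSubgraphOfG G F → ∀ C y → E F C y ≡ true → ∃ λ b → (y , b) ∈ φ C
  literalOn F (_ , F⊆G) C y e with find (F⊆G C y e)
  ... | (y , b) , l∈C , refl = b , l∈C

  module _ {F K : Subgraph G} (matching : Is24Matching G F) (isComponent : IsComponent G F K) where
    open Component isComponent

    InK : Fin m → Set
    InK C = V K (inj₁ C) ≡ true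

    clauses variables : ℕ
    clauses   = count m (λ C → V K (inj₁ C))
    variables = count n (λ x → V K (inj₂ x))

    neighbour-in-K : ∀ {C y} → InK C → E F C y ≡ true → V K (inj₂ y) ≡ true
    neighbour-in-K {C} {y} kC e = proj₂ (wellFormed C y (closed C y e (inj₁ kC)))

    neighbours : ∀ C → InK C → Exactly₂ (E F C)
    neighbours C kC = count≡2⇒exactly₂ n (proj₂ (proj₂ matching) C (V⊆ (inj₁ C) kC))

    edges≡2·clauses : countE G K ≡ clauses + clauses
    edges≡2·clauses = trans (sumFin-cong m row) (sumFin-+ m _ _)
      where
      row : ∀ C → count n (E K C) ≡ b2n (V K (inj₁ C)) + b2n (V K (inj₁ C))
      row C with V K (inj₁ C) in kC
      ... | true  = trans (sumFin-cong n (λ x → cong b2n (E-row x)))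
                          (proj₂ (proj₂ matching) C (V⊆ (inj₁ C) kC))
        where
        E-row : ∀ x → E K C x ≡ E F C x
        E-row x with E F C x in e
        ... | true  = closed C x e (inj₁ kC)
        ... | false with E K C x in e′
        ...   | true  = ⊥-elim (false≢true (trans (sym e) (E⊆ C x e′)))
        ...   | false = refl
      ... | false = count-none n (λ x e → false≢true (trans (sym kC) (proj₁ (wellFormed C x e))))

    clauses≤2 : clauses ≤ 2
    clauses≤2 with clauses ≤? 2
    ... | yes c≤2 = c≤2
    ... | no  c≰2 = ⊥-elim (<⇒≱ (+-mono-< (≰⇒> c≰2) (≰⇒> c≰2)) (subst (_≤ 4) edges≡2·clauses edges≤4))
      where edges≤4 = proj₂ (proj₁ (proj₂ matching) K isComponent)

    variables≡1+clauses : variables ≡ suc clauses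
    variables≡1+clauses = trans (sym (+-cancelˡ-≡ clauses _ _ counts)) (ℕₚ.+-comm clauses 1)
      where
      open ≡-Reasoning
      counts : clauses + (clauses + 1) ≡ clauses + variables
      counts = begin
        clauses + (clauses + 1) ≡⟨ sym (ℕₚ.+-assoc clauses clauses 1) ⟩
        clauses + clauses + 1   ≡⟨ cong (_+ 1) edges≡2·clauses ⟨
        countE G K + 1          ≡⟨ proj₂ (proj₁ (proj₁ (proj₂ matching) K isComponent)) ⟩
        clauses + variables     ∎

    variable-has-clause : ∀ {C t} → InK C → V K (inj₂ t) ≡ true → ∃ λ C′ → InK C′ × E F C′ t ≡ true
    variable-has-clause {C} {t} kC kt with connected (inj₂ t) (inj₁ C) kt kC
    ... | rl C′ .t e ◅ _ = C′ , proj₁ (wellFormed C′ t e) , E⊆ C′ t e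

    variables≤2 : ∀ {C} → InK C → (∀ C′ → InK C′ → ∀ t → E F C′ t ≡ true → E F C t ≡ true) →
                  variables ≤ 2
    variables≤2 {C} kC nested with neighbours C kC
    ... | c₁ , c₂ , _ , _ , _ , only = count≤length n (c₁ ∷ c₂ ∷ []) K-variable-∈
      where
      K-variable-∈ : ∀ t → V K (inj₂ t) ≡ true → t ∈ c₁ ∷ c₂ ∷ []
      K-variable-∈ t kt with variable-has-clause kC kt
      ... | C′ , kC′ , e with only t (nested C′ kC′ t e)
      ...   | inj₁ refl = here refl
      ...   | inj₂ refl = there (here refl)

    Witness : Fin n → Bool → Set
    Witness x c = ∃ λ w → SatisfiesWithin K w × lookup w x ≡ c

    witness-from-literals : ∀ x c (ls : List (Literal n)) → AllPairs (λ l l′ → proj₁ l ≢ proj₁ l′) ls →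
                            All (λ l → proj₁ l ≢ x) ls →
                            (∀ C → InK C → Any (λ l → l ∈ φ C × V K (inj₂ (proj₁ l)) ≡ true) ls) →
                            Witness x c
    witness-from-literals x c ls distinct avoid covers =
      w , satisfies , trans (lookup∘tabulate _ x) (assignLiterals-default ls c avoid)
      where
      w = tabulate (assignLiterals ls c)
      satisfies : SatisfiesWithin K w
      satisfies C kC with find (covers C kC)
      ... | l , l∈ls , l∈C , kl =
        lose l∈C (kl , trans (lookup∘tabulate _ (proj₁ l)) (assignLiterals-literal ls c distinct l∈ls))

    literalAt : ∀ C y → E F C y ≡ true → Literal n
    literalAt C y e = y , proj₁ (literalOn F (proj₁ matching) C y e)

    literalAt-∈ : ∀ C y (e : E F C y ≡ true) → literalAt C y e ∈ φ C
    literalAt-∈ C y e = proj₂ (literalOn F (proj₁ matching) C y e)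

    flip-one-clause : ∀ x c → (∃ λ C → InK C × (∀ C′ → InK C′ → C′ ≡ C)) → Witness x c
    flip-one-clause x c (C , kC , only) with exactly₂-avoid (neighbours C kC) x
    ... | y , e , y≢x =
      witness-from-literals x c (literalAt C y e ∷ []) ([] ∷ []) (y≢x ∷ [])
        (λ C′ kC′ → case only C′ kC′ of λ { refl → here (literalAt-∈ C y e , neighbour-in-K kC e) })

    -- two clauses with nested neighbourhoods would leave K with only two variables
    flip-two-clauses : ∀ x c → clauses ≡ 2 → Witness x c
    flip-two-clauses x c #clauses with count≡2⇒exactly₂ m #clauses
    ... | C , D , _ , kC , kD , only
      with exactly₂-representatives (neighbours C kC) (neighbours D kD) D⊈C x
      where
      D⊈C : ¬ (∀ t → E F D t ≡ true → E F C t ≡ true)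
      D⊈C D⊆C = <⇒≱ (≤-reflexive (sym (trans variables≡1+clauses (cong suc #clauses)))) (variables≤2 kC nested)
        where
        nested : ∀ C′ → InK C′ → ∀ t → E F C′ t ≡ true → E F C t ≡ true
        nested C′ kC′ t e with only C′ kC′
        ... | inj₁ refl = e
        ... | inj₂ refl = D⊆C t e
    ... | p , q , eCp , eDq , p≢x , q≢x , p≢q =
      witness-from-literals x c (literalAt C p eCp ∷ literalAt D q eDq ∷ [])
        ((p≢q ∷ []) ∷ [] ∷ []) (p≢x ∷ q≢x ∷ [])
        (λ C′ kC′ → case only C′ kC′ of λ
          { (inj₁ refl) → here (literalAt-∈ C p eCp , neighbour-in-K kC eCp)
          ; (inj₂ refl) → there (here (literalAt-∈ D q eDq , neighbour-in-K kD eDq)) })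

    -- each clause of K gets a literal on its own variable of K other than x
    flip : ∀ x c → Witness x c
    flip x c with clauses in #clauses
    ... | 0                 = witness-from-literals x c [] [] [] (λ C kC → ⊥-elim (count≡0⇒none m #clauses C kC))
    ... | 1                 = flip-one-clause x c (count≡1⇒single m #clauses)
    ... | 2                 = flip-two-clauses x c #clauses
    ... | suc (suc (suc _)) = ⊥-elim (<⇒≱ (s≤s (s≤s (s≤s z≤n))) (subst (_≤ 2) #clauses clauses≤2))

module ComponentFactors {c ℓ} (𝔽 : Field c ℓ) {n m : ℕ} (φ : CNF n m) where
  open Alg 𝔽 n
  open ProductFamilies 𝔽 n
  open ComponentAssignments φ
  open Components G

  restrict : Subgraph G → Vec Bool n → PA
  restrict K w = tabulate (λ x → if V K (inj₂ x) then just (lookup w x) else nothing)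

  lookup-restrict : ∀ K w x → lookup (restrict K w) x ≡ (if V K (inj₂ x) then just (lookup w x) else nothing)
  lookup-restrict K w = lookup∘tabulate _

  restrict-in : ∀ K w x → V K (inj₂ x) ≡ true → lookup (restrict K w) x ≡ just (lookup w x)
  restrict-in K w x kx rewrite lookup-restrict K w x | kx = refl

  restrict-domain : ∀ K w x → InDom (restrict K w) x → V K (inj₂ x) ≡ true
  restrict-domain K w x (b , e) rewrite lookup-restrict K w x with V K (inj₂ x)
  ... | true = refl

  -- what α must do for the polynomials of tr(φ) belonging to the vertex v to vanish under it
  Fulfils : PA → Vertex G → Set
  Fulfils α (inj₁ C) = Any (λ l → lookup α (proj₁ l) ≡ just (proj₂ l)) (φ C)
  Fulfils α (inj₂ x) = InDom α x

  record IsFactorOf (K : Subgraph G) (H : Factor) : Set where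
    field
      nonEmpty  : NonEmpty H
      flippable : FlippableFactor H
      domain    : ∀ {α} → α ∈ H → ∀ x → InDom α x → V K (inj₂ x) ≡ true
      fulfils   : ∀ {α} → α ∈ H → ∀ v → V K v ≡ true → Fulfils α v

  IsFactorOf-SameSet : ∀ {K H H′} → SameSet H H′ → IsFactorOf K H′ → IsFactorOf K H
  IsFactorOf-SameSet H≈H′ isFactor = record
    { nonEmpty  = let (α , α∈H′) = nonEmpty in α , proj₂ (H≈H′ α) α∈H′
    ; flippable = SameSet-flippable H≈H′ flippable
    ; domain    = λ {α} → domain ∘ proj₁ (H≈H′ α)
    ; fulfils   = λ {α} → fulfils ∘ proj₁ (H≈H′ α)
    }
    where open IsFactorOf isFactor

  Fulfils-extends : ∀ {α β} → α extends β → ∀ v → Fulfils β v → Fulfils α v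
  Fulfils-extends α⊇β (inj₁ C) = Any.map (α⊇β _)
  Fulfils-extends α⊇β (inj₂ x) (b , βx) = b , α⊇β x βx

  Fulfils-assigns : ∀ α v → Fulfils α v → ∃ λ x → InDom α x
  Fulfils-assigns α (inj₁ C) sat with find sat
  ... | (y , b) , _ , αy = y , b , αy
  Fulfils-assigns α (inj₂ x) x∈α = x , x∈α

  IsFactorOf-domain : ∀ {K H} → IsFactorOf K H → ∀ x → FactorDom H x → V K (inj₂ x) ≡ true
  IsFactorOf-domain isFactor x x∈dom with find x∈dom
  ... | α , α∈H , x∈α = IsFactorOf.domain isFactor α∈H x x∈α

  IsFactorOf-nonStar : ∀ {F K H} → IsComponent G F K → IsFactorOf K H → isStarFactor H ≡ false
  IsFactorOf-nonStar isComponent isFactor with Component.inhabited isComponent | IsFactorOf.nonEmpty isFactor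
  ... | v , kv | α , α∈H with Fulfils-assigns α v (IsFactorOf.fulfils isFactor α∈H v kv)
  ...   | x , b , αx = ¬isStarFactor α∈H (assigned⇒¬isStarPA α x αx)

  restrict-fulfils : ∀ K w → SatisfiesWithin K w → ∀ v → V K v ≡ true → Fulfils (restrict K w) v
  restrict-fulfils K w sat (inj₁ C) kC =
    Any.map (λ {l} (kl , wl) → trans (restrict-in K w (proj₁ l) kl) (cong just wl)) (sat C kC)
  restrict-fulfils K w sat (inj₂ x) kx = lookup w x , restrict-in K w x kx

  module _ {F K : Subgraph G} (matching : Is24Matching G F) (isComponent : IsComponent G F K) where
    witness : Fin n → Bool → Vec Bool n
    witness x c = proj₁ (flip matching isComponent x c)

    componentFactor : Factor
    componentFactor = cartesianProductWith (λ x c → restrict K (witness x c)) (allFin n) (true ∷ false ∷ [])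

    witness-∈ : ∀ x c → c ∈ true ∷ false ∷ [] → restrict K (witness x c) ∈ componentFactor
    witness-∈ x c c∈ = ∈-cartesianProductWith⁺ (λ x c → restrict K (witness x c)) (∈-allFin x) c∈

    componentFactor-elements : ∀ {α} → α ∈ componentFactor → ∃₂ λ x c → α ≡ restrict K (witness x c)
    componentFactor-elements α∈ with ∈-cartesianProductWith⁻ (λ x c → restrict K (witness x c)) (allFin n) _ α∈
    ... | x , c , _ , _ , α≡ = x , c , α≡

    some-variable : ∃ λ y → V K (inj₂ y) ≡ true
    some-variable with Component.inhabited isComponent
    ... | inj₂ y , ky = y , ky
    ... | inj₁ C , kC with neighbours matching isComponent C kC
    ...   | y , _ , _ , e , _ = y , neighbour-in-K matching isComponent kC e

    componentFactor-domain : ∀ {α} → α ∈ componentFactor → ∀ x → InDom α x → V K (inj₂ x) ≡ true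
    componentFactor-domain α∈ x x∈α with componentFactor-elements α∈
    ... | y , c , refl = restrict-domain K (witness y c) x x∈α

    witness-value : ∀ x c → V K (inj₂ x) ≡ true → lookup (restrict K (witness x c)) x ≡ just c
    witness-value x c kx =
      trans (restrict-in K (witness x c) x kx) (cong just (proj₂ (proj₂ (flip matching isComponent x c))))

    componentFactor-flippable : FlippableFactor componentFactor
    componentFactor-flippable x x∈dom with find x∈dom
    ... | α , α∈ , x∈α =
      _ , _ , witness-∈ x true (here refl) , witness-∈ x false (there (here refl)) , true ,
      witness-value x true kx , witness-value x false kx
      where kx = componentFactor-domain α∈ x x∈α

    componentFactor-fulfils : ∀ {α} → α ∈ componentFactor → ∀ v → V K v ≡ true → Fulfils α v
    componentFactor-fulfils α∈ v kv with componentFactor-elements α∈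
    ... | y , c , refl = restrict-fulfils K (witness y c) (proj₁ (proj₂ (flip matching isComponent y c))) v kv

    componentFactor-isFactor : IsFactorOf K componentFactor
    componentFactor-isFactor = record
      { nonEmpty  = _ , witness-∈ (proj₁ some-variable) true (here refl)
      ; flippable = componentFactor-flippable
      ; domain    = componentFactor-domain
      ; fulfils   = componentFactor-fulfils
      }

-- The strategy

module Strategy {c ℓ} (𝔽 : Field c ℓ) {n m : ℕ} (φ : CNF n m) (μ : ℕ)
                (coverer : CovererWins (adjGraph φ) μ) where
  open Alg 𝔽 n
  open Evaluation 𝔽 n
  open ProductFamilies 𝔽 n
  open ComponentAssignments φ
  open ComponentFactors 𝔽 φ
  open Components G

  W : Subgraph G → Set
  W = proj₁ coverer

  W-empty : W (emptySubgraph G)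
  W-empty = proj₁ (proj₂ coverer)

  W-matching : ∀ F → W F → Is24Matching G F
  W-matching = proj₁ (proj₂ (proj₂ coverer))

  W-∖ᵍ : ∀ F H → W F → IsComponent G F H → W (_∖ᵍ_ G F H)
  W-∖ᵍ = proj₁ (proj₂ (proj₂ (proj₂ coverer)))

  W-answer : ∀ F → W F → FewerComponents G F μ → ∀ v →
             ∃ λ F′ → W F′ × Is24Matching G F′ × Covers G F′ v × KeepsComponents G F F′
  W-answer = proj₂ (proj₂ (proj₂ (proj₂ coverer)))

  open Pruning W (λ F wF → proj₁ (proj₁ (W-matching F wF))) W-∖ᵍ

  data Represents : ProductFamily → List (Subgraph G) → Set where
    []     : Represents [] []
    star   : ∀ {H 𝓗 Ks} → T (isStarFactor H) → Represents 𝓗 Ks → Represents (H ∷ 𝓗) Ks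
    factor : ∀ {H 𝓗 K Ks} → isStarFactor H ≡ false → IsFactorOf K H → Represents 𝓗 Ks →
             Represents (H ∷ 𝓗) (K ∷ Ks)

  represents-length : ∀ {𝓗 Ks} → Represents 𝓗 Ks → length Ks ≡ rank 𝓗
  represents-length []                   = refl
  represents-length (star {H} t r)       rewrite Equivalence.to T-≡ t = represents-length r
  represents-length (factor {H} ¬⋆ _ r) rewrite ¬⋆ = cong suc (represents-length r)

  represents-factorOf : ∀ {𝓗 Ks K} → Represents 𝓗 Ks → K ∈ Ks → ∃ λ H → H ∈ 𝓗 × IsFactorOf K H
  represents-factorOf (star _ r) K∈Ks with represents-factorOf r K∈Ks
  ... | H , H∈𝓗 , isFactor = H , there H∈𝓗 , isFactor
  represents-factorOf (factor _ isFactor _) (here refl) = _ , here refl , isFactor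
  represents-factorOf (factor _ _ r) (there K∈Ks) with represents-factorOf r K∈Ks
  ... | H , H∈𝓗 , isFactor = H , there H∈𝓗 , isFactor

  represents-component : ∀ {𝓗 Ks H} → Represents 𝓗 Ks → H ∈ 𝓗 → isStarFactor H ≡ false →
                         ∃ λ K → K ∈ Ks × IsFactorOf K H
  represents-component (star t _) (here refl) ¬⋆ = ⊥-elim (subst T ¬⋆ t)
  represents-component (star _ r) (there H∈𝓗) ¬⋆ = represents-component r H∈𝓗 ¬⋆
  represents-component (factor _ isFactor _) (here refl) _ = _ , here refl , isFactor
  represents-component (factor _ _ r) (there H∈𝓗) ¬⋆ with represents-component r H∈𝓗 ¬⋆
  ... | K , K∈Ks , isFactor = K , there K∈Ks , isFactor

  represents-disjoint : ∀ {𝓗 Ks K H} → Represents 𝓗 Ks → IsFactorOf K H →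
                        (∀ {K′} → K′ ∈ Ks → ∀ x → V K (inj₂ x) ≡ true → V K′ (inj₂ x) ≡ true → ⊥) →
                        All (λ H′ → ∀ x → FactorDom H x → FactorDom H′ x → ⊥) 𝓗
  represents-disjoint []                 _        _        = []
  represents-disjoint (star {H′} t r)    isFactor disjoint =
    (λ x _ x∈H′ → isStarFactor-domain H′ t x x∈H′) ∷ represents-disjoint r isFactor disjoint
  represents-disjoint (factor _ isFactor′ r) isFactor disjoint =
    (λ x x∈H x∈H′ → disjoint (here refl) x (IsFactorOf-domain isFactor x x∈H)
                                            (IsFactorOf-domain isFactor′ x x∈H′)) ∷
    represents-disjoint r isFactor (disjoint ∘ there)

  represents-⊑ : ∀ {𝓗 Ks} 𝓗′ → 𝓗′ ⊑ 𝓗 → Represents 𝓗 Ks →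
                 ∃ λ Ks′ → Represents 𝓗′ Ks′ × (∀ {K} → K ∈ Ks′ → K ∈ Ks)
  represents-⊑ []         []             r = [] , [] , λ ()
  represents-⊑ (H′ ∷ 𝓗′) (H′⊑ ∷ 𝓗′⊑) r with represents-⊑ 𝓗′ 𝓗′⊑ r | isStarFactor H′ in ⋆
  ... | Ks′ , r′ , Ks′⊆Ks | true  = Ks′ , star (subst T (sym ⋆) tt) r′ , Ks′⊆Ks
  ... | Ks′ , r′ , Ks′⊆Ks | false with H′⊑
  ...   | inj₁ ()
  ...   | inj₂ same with find same
  ...     | H , H∈𝓗 , H′≈H with represents-component r H∈𝓗 (SameSet-¬isStarFactor H′≈H ⋆)
  ...       | K , K∈Ks , isFactor =
    K ∷ Ks′ , factor ⋆ (IsFactorOf-SameSet H′≈H isFactor) r′ ,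
    λ { (here refl) → K∈Ks ; (there K∈Ks′) → Ks′⊆Ks K∈Ks′ }

  record Position (𝓗 : ProductFamily) : Set where
    field
      flippablePF   : IsFlippablePF 𝓗
      matching      : Subgraph G
      inW           : W matching
      components    : List (Subgraph G)
      areComponents : All (IsComponent G matching) components
      covering      : ∀ v → V matching v ≡ true → Covered components v
      represents    : Represents 𝓗 components

  position-[] : Position []
  position-[] = record
    { flippablePF = ([] , []) , [] ; matching = emptySubgraph G ; inW = W-empty ; components = []
    ; areComponents = [] ; covering = λ v () ; represents = [] }

  Answer : ProductFamily → Polynomial → Set ℓ
  Answer 𝓗 p = ∃ λ 𝓗′ → Position 𝓗′ × IsFlippablePF 𝓗′ × 𝓗 ⊑ 𝓗′ × 𝓗′ ⊨PF p

  Entails : Vertex G → Polynomial → Set ℓ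
  Entails v p = ∀ α → Fulfils α v → α ⊨ p

  factor-⊨ : ∀ {𝓗 H K v} p → IsProductFamily 𝓗 → H ∈ 𝓗 → IsFactorOf K H → V K v ≡ true → Entails v p →
             𝓗 ⊨PF p
  factor-⊨ {v = v} p isPF H∈𝓗 isFactor kv entails α α∈𝓗 with ∈PF-extends isPF α∈𝓗 H∈𝓗
  ... | β , β∈H , α⊇β = entails α (Fulfils-extends α⊇β v (IsFactorOf.fulfils isFactor β∈H v kv))

  module _ {𝓗} (pos : Position 𝓗) where
    open Position pos

    position-⊑ : ∀ 𝓗′ → IsProductFamily 𝓗′ → 𝓗′ ⊑ 𝓗 → Position 𝓗′
    position-⊑ 𝓗′ isPF 𝓗′⊑𝓗 with represents-⊑ 𝓗′ 𝓗′⊑𝓗 represents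
    ... | Ks′ , r′ , Ks′⊆Ks with prune matching Ks′ inW (All.tabulate (All.lookup areComponents ∘ Ks′⊆Ks))
    ...   | F₀ , wF₀ , areComponents₀ , covering₀ = record
      { flippablePF = isPF , All.map flippable 𝓗′⊑𝓗 ; matching = F₀ ; inW = wF₀ ; components = Ks′
      ; areComponents = areComponents₀ ; covering = covering₀ ; represents = r′ }
      where
      flippable : ∀ {H′} → T (isStarFactor H′) ⊎ Any (SameSet H′) 𝓗 → FlippableFactor H′
      flippable {H′} (inj₁ t) x x∈dom = ⊥-elim (isStarFactor-domain H′ t x x∈dom)
      flippable (inj₂ same) with find same
      ... | H , H∈𝓗 , H′≈H = SameSet-flippable H′≈H (All.lookup (proj₂ flippablePF) H∈𝓗)

    answer-covered : ∀ v p → Entails v p → Covered components v → Answer 𝓗 p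
    answer-covered v p entails v∈Ks with find v∈Ks
    ... | K , K∈Ks , kv with represents-factorOf represents K∈Ks
    ...   | H , H∈𝓗 , isFactor =
      𝓗 , pos , flippablePF , ⊑-⊆ id , factor-⊨ p (proj₁ flippablePF) H∈𝓗 isFactor kv entails

    fewerComponents : rank 𝓗 < μ → FewerComponents G matching μ
    fewerComponents rank<μ =
      components , areComponents , subst (_< μ) (sym (represents-length represents)) rank<μ , covering

    -- Chooser challenges v; the component of Coverer's answer through v becomes a new factor
    answer-by-challenge : rank 𝓗 < μ → ∀ v p → Entails v p → ¬ Covered components v → Answer 𝓗 p
    answer-by-challenge rank<μ v p entails v∉Ks with W-answer matching inW (fewerComponents rank<μ) v
    ... | F′ , wF′ , matching′ , F′v , keeps =
      extend (prune F′ (K ∷ components) wF′ (cK ∷ All.map (λ {H} → keeps H) areComponents))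
      where
      K = componentOf F′ v
      cK : IsComponent G F′ K
      cK = componentOf-isComponent F′ (proj₁ (proj₁ matching′)) v F′v
      extend : Pruned (K ∷ components) → Answer 𝓗 p
      extend (F″ , wF″ , cK″ ∷ areComponents″ , covering″) =
        H ∷ 𝓗 , position′ , flippablePF′ , ⊑-⊆ there ,
        factor-⊨ p (proj₁ flippablePF′) (here refl) isFactor (reach-self F′ v) entails
        where
        H = componentFactor (W-matching F″ wF″) cK″
        isFactor = componentFactor-isFactor (W-matching F″ wF″) cK″
        disjoint : ∀ {K′} → K′ ∈ components → ∀ x → V K (inj₂ x) ≡ true → V K′ (inj₂ x) ≡ true → ⊥
        disjoint K′∈Ks x kx k′x = v∉Ks (lose K′∈Ks
          (components-overlap (All.lookup areComponents″ K′∈Ks) cK″ (inj₂ x) k′x kx v (reach-self F′ v)))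
        flippablePF′ : IsFlippablePF (H ∷ 𝓗)
        flippablePF′ =
          (IsFactorOf.nonEmpty isFactor ∷ proj₁ (proj₁ flippablePF) ,
           represents-disjoint represents isFactor disjoint ∷ proj₂ (proj₁ flippablePF)) ,
          IsFactorOf.flippable isFactor ∷ proj₂ flippablePF
        position′ : Position (H ∷ 𝓗)
        position′ = record
          { flippablePF = flippablePF′ ; matching = F″ ; inW = wF″ ; components = K ∷ components
          ; areComponents = cK″ ∷ areComponents″ ; covering = covering″
          ; represents = factor (IsFactorOf-nonStar cK″ isFactor) isFactor represents }

    answer : rank 𝓗 < μ → ∀ v p → Entails v p → Answer 𝓗 p
    answer rank<μ v p entails with covered? components v
    ... | yes v∈Ks = answer-covered v p entails v∈Ks
    ... | no  v∉Ks = answer-by-challenge rank<μ v p entails v∉Ks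

    answers : rank 𝓗 < μ → All (Answer 𝓗) (tr φ)
    answers rank<μ = ++⁺
      (map⁺ (tabulate⁺ λ C → answer rank<μ (inj₁ C) (trClause (φ C)) (λ α → clause-sound α (φ C))))
      (concat⁺ (map⁺ (tabulate⁺ λ x →
        answer rank<μ (inj₂ x) (boolAxiom x) (λ α → boolAxiom-sound α x) ∷
        answer rank<μ (inj₂ x) (negAxiom x) (λ α → negAxiom-sound α x) ∷ [])))

  winningStrategy : HasWinningStrategy μ (tr φ)
  winningStrategy = Position , ([] , position-[]) , (λ _ → Position.flippablePF) , (λ _ → position-⊑) , (λ _ → answers)

-- The construction does not need φ to be an unsatisfiable 3-CNF in which every variable occurs.
theorem21 : ∀ {c ℓ} (𝔽 : Field c ℓ) (n m : ℕ) (φ : CNF n m) →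
    Is3CNF φ → AllVarsOccur φ → Unsatisfiable φ →
    (μ : ℕ) → CovererWins (adjGraph φ) μ →
    Alg.HasWinningStrategy 𝔽 n μ (Alg.tr 𝔽 n φ)
theorem21 𝔽 n m φ _ _ _ μ coverer = Strategy.winningStrategy 𝔽 φ μ coverer
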